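{- Let $d\in\mathbb Z_{>0}$ and $s\in\{ -1,1\}$. Then there exist infinitely many positive integers $n$ of the special form such that $\Phi_n(T)\equiv 1+sT^d \pmod{T^{2d}}$.
   Context: $\Phi_n(T)\in\mathbb Z[T]$ denotes the $n$-th cyclotomic polynomial (the monic irreducible polynomial over $\mathbb Q$ of a primitive $n$-th root of unity). A positive integer $n$ is of the special form if $n=pm$ with $p$ prime and $m$ a positive integer dividing $p-1$. -}

module Defs where

open import Data.Nat as ℕ using (ℕ; zero; suc; _∸_; _≡ᵇ_; _<_; _≤_)
open import Data.Nat.Divisibility using (_∣_; _∣?_)
open import Data.Nat.Primality using (Prime)
open import Data.Integer as ℤ using (ℤ; +_; -_)
open import Data.List using (List; filter; map; upTo; foldr)
open import Data.Bool using (if_then_else_)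
open import Data.Product using (∃; ∃-syntax; _×_)
open import Relation.Binary.PropositionalEquality using (_≡_)

-- Formal power series over ℤ, given by their coefficient functions
-- (coefficient of T^k at index k).  Polynomials in ℤ[T] embed as the
-- finitely supported ones.
Series : Set
Series = ℕ → ℤ

convAux : Series → Series → ℕ → ℕ → ℤ
convAux f g k zero    = f 0 ℤ.* g k
convAux f g k (suc i) = f (suc i) ℤ.* g (k ∸ suc i) ℤ.+ convAux f g k i

_⊛_ : Series → Series → Series
(f ⊛ g) k = convAux f g k k

oneS : Series
oneS zero    = + 1
oneS (suc _) = + 0

TnMinus1 : ℕ → Series
TnMinus1 n k = if k ≡ᵇ 0 then - (+ 1) else (if k ≡ᵇ n then + 1 else + 0)

onePlusSTd : ℤ → ℕ → Series
onePlusSTd s d k = if k ≡ᵇ 0 then + 1 else (if k ≡ᵇ d then s else + 0)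

divisors : ℕ → List ℕ
divisors n = filter (_∣? n) (map suc (upTo n))

prodS : (ℕ → Series) → List ℕ → Series
prodS Φ = foldr (λ e acc → Φ e ⊛ acc) oneS

-- Φ is the family of cyclotomic polynomials: for every n ≥ 1,
--   ∏_{e ∣ n} Φ_e(T) = T^n - 1.
-- This determines every Φ_n (n ≥ 1) uniquely, by induction on n, since
-- ∏_{e ∣ n, e < n} Φ_e has constant term ±1, a unit.
IsCyclotomicFamily : (ℕ → Series) → Set
IsCyclotomicFamily Φ = ∀ n → 1 ≤ n → ∀ k → prodS Φ (divisors n) k ≡ TnMinus1 n k

SpecialForm : ℕ → Set
SpecialForm n = ∃[ p ] ∃[ m ] (Prime p × m ∣ p ∸ 1 × n ≡ p ℕ.* m)

_≡_modT^_ : Series → Series → ℕ → Set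
f ≡ g modT^ N = ∀ k → k < N → f k ≡ g k

{-# OPTIONS --safe #-}
-- Write n = d r₁ ⋯ r_k with distinct primes r_i that include every prime factor of d.
-- Möbius inversion of ∏_{e ∣ n} Φ_e = T^n - 1 writes Φ_n as the alternating product of the
-- T^(n/e) - 1 over the squarefree e ∣ r₁ ⋯ r_k. Modulo T^(2d) every factor with e ≠ r₁ ⋯ r_k is
-- -1, and these cancel in pairs, so Φ_n ≡ (1 - T^d)^(±1) ≡ 1 ∓ T^d, the sign being given by the
-- parity of k. Taking r₁ = p prime with m = n / p dividing p - 1 puts n in the special form, and
-- one or two further primes above d fix the parity. Primes p ≡ 1 (mod m) beyond any bound N come
-- from the same alternating product for G(y) = a^y - 1, a = 2 m N!: a prime q at which its
-- valuation is nonzero does not divide a, so q > N, and a has order exactly m modulo q.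

module Submission where

open import Algebra.Bundles using (CommutativeMonoid)

module Series where

  open import Defs
  open import Data.Nat as ℕ using (ℕ; zero; suc; _∸_; _≤_; _<_; z≤n)
  import Data.Nat.Properties as ℕP
  open import Data.Integer as ℤ using (ℤ; +_; _+_; _*_)
  import Data.Integer.Properties as ℤP
  open import Data.Integer.Tactic.RingSolver using (solve-∀)
  open import Data.Product using (_,_)
  open import Function using (_∘_)
  open import Level using (0ℓ)
  open import Relation.Binary.PropositionalEquality

  open ≡-Reasoning

  sumTo : (ℕ → ℤ) → ℕ → ℤ
  sumTo F zero    = F 0
  sumTo F (suc i) = F (suc i) + sumTo F i

  sumTo-cong : ∀ {F G} i → (∀ j → j ≤ i → F j ≡ G j) → sumTo F i ≡ sumTo G i
  sumTo-cong zero    F≡G = F≡G 0 z≤n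
  sumTo-cong (suc i) F≡G =
    cong₂ _+_ (F≡G (suc i) ℕP.≤-refl) (sumTo-cong i (λ j j≤i → F≡G j (ℕP.m≤n⇒m≤1+n j≤i)))

  sumTo-+ : ∀ F G i → sumTo (λ j → F j + G j) i ≡ sumTo F i + sumTo G i
  sumTo-+ F G zero    = refl
  sumTo-+ F G (suc i) = begin
    (F (suc i) + G (suc i)) + sumTo (λ j → F j + G j) i ≡⟨ cong (_+_ (F (suc i) + G (suc i))) (sumTo-+ F G i) ⟩
    (F (suc i) + G (suc i)) + (sumTo F i + sumTo G i)   ≡⟨ interchange (F (suc i)) (G (suc i)) _ _ ⟩
    (F (suc i) + sumTo F i) + (G (suc i) + sumTo G i)   ∎
    where
    interchange : ∀ a b c d → (a + b) + (c + d) ≡ (a + c) + (b + d)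
    interchange = solve-∀

  *-distribˡ-sumTo : ∀ c F i → c * sumTo F i ≡ sumTo (λ j → c * F j) i
  *-distribˡ-sumTo c F zero    = refl
  *-distribˡ-sumTo c F (suc i) =
    trans (ℤP.*-distribˡ-+ c (F (suc i)) (sumTo F i)) (cong (_+_ (c * F (suc i))) (*-distribˡ-sumTo c F i))

  *-distribʳ-sumTo : ∀ c F i → sumTo F i * c ≡ sumTo (λ j → F j * c) i
  *-distribʳ-sumTo c F i = begin
    sumTo F i * c            ≡⟨ ℤP.*-comm (sumTo F i) c ⟩
    c * sumTo F i            ≡⟨ *-distribˡ-sumTo c F i ⟩
    sumTo (λ j → c * F j) i  ≡⟨ sumTo-cong i (λ j _ → ℤP.*-comm c (F j)) ⟩
    sumTo (λ j → F j * c) i  ∎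

  sumTo-suc : ∀ F i → sumTo F (suc i) ≡ F 0 + sumTo (F ∘ suc) i
  sumTo-suc F zero    = ℤP.+-comm (F 1) (F 0)
  sumTo-suc F (suc i) = begin
    F (2 ℕ.+ i) + sumTo F (suc i)           ≡⟨ cong (_+_ (F (2 ℕ.+ i))) (sumTo-suc F i) ⟩
    F (2 ℕ.+ i) + (F 0 + sumTo (F ∘ suc) i) ≡⟨ left-comm (F (2 ℕ.+ i)) (F 0) _ ⟩
    F 0 + (F (2 ℕ.+ i) + sumTo (F ∘ suc) i) ∎
    where
    left-comm : ∀ a b c → a + (b + c) ≡ b + (a + c)
    left-comm = solve-∀

  sumTo-reverse : ∀ F i → sumTo F i ≡ sumTo (λ j → F (i ∸ j)) i
  sumTo-reverse F zero    = refl
  sumTo-reverse F (suc i) = begin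
    F (suc i) + sumTo F i                          ≡⟨ cong (_+_ (F (suc i))) (sumTo-reverse F i) ⟩
    F (suc i) + sumTo (λ j → F (i ∸ j)) i          ≡⟨ sym (sumTo-suc (λ j → F (suc i ∸ j)) i) ⟩
    sumTo (λ j → F (suc i ∸ j)) (suc i)            ∎

  sumTo-head : ∀ F i → (∀ j → F (suc j) ≡ + 0) → sumTo F i ≡ F 0
  sumTo-head F zero    _    = refl
  sumTo-head F (suc i) tail0 =
    trans (cong₂ _+_ (tail0 i) (sumTo-head F i tail0)) (ℤP.+-identityˡ (F 0))

  sumTo-extend : ∀ (F : ℕ → ℤ) {k i} → i ≤ k →
    sumTo (λ j → F (i ℕ.+ j)) (suc k ∸ i) ≡ F (suc k) + sumTo (λ j → F (i ℕ.+ j)) (k ∸ i)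
  sumTo-extend F {k} {i} i≤k rewrite ℕP.+-∸-assoc 1 i≤k =
    cong (λ a → F a + sumTo (λ j → F (i ℕ.+ j)) (k ∸ i)) (trans (ℕP.+-suc i (k ∸ i)) (cong suc (ℕP.m+[n∸m]≡n i≤k)))

  sumTo-swap : ∀ (H : ℕ → ℕ → ℤ) k →
    sumTo (λ a → sumTo (λ i → H i a) a) k ≡ sumTo (λ i → sumTo (λ j → H i (i ℕ.+ j)) (k ∸ i)) k
  sumTo-swap H zero    = refl
  sumTo-swap H (suc k) = begin
    (H (suc k) (suc k) + sumTo (λ i → H i (suc k)) k) + sumTo (λ a → sumTo (λ i → H i a) a) k
      ≡⟨ cong (_+_ (H (suc k) (suc k) + sumTo (λ i → H i (suc k)) k)) (sumTo-swap H k) ⟩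
    (H (suc k) (suc k) + sumTo (λ i → H i (suc k)) k) + sumTo (λ i → Row i (k ∸ i)) k
      ≡⟨ ℤP.+-assoc (H (suc k) (suc k)) _ _ ⟩
    H (suc k) (suc k) + (sumTo (λ i → H i (suc k)) k + sumTo (λ i → Row i (k ∸ i)) k)
      ≡⟨ cong₂ _+_ (cong (H (suc k)) (sym (ℕP.+-identityʳ (suc k)))) (sym (sumTo-+ _ _ k)) ⟩
    Row (suc k) 0 + sumTo (λ i → H i (suc k) + Row i (k ∸ i)) k
      ≡⟨ cong₂ (λ a b → Row (suc k) a + b) (sym (ℕP.n∸n≡0 k))
               (sumTo-cong {G = λ i → Row i (suc k ∸ i)} k (λ i i≤k → sym (sumTo-extend (H i) i≤k))) ⟩
    sumTo (λ i → Row i (suc k ∸ i)) (suc k) ∎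
    where
    Row : ℕ → ℕ → ℤ
    Row i = sumTo (λ j → H i (i ℕ.+ j))

  ⊛-as-sumTo : ∀ f g k → (f ⊛ g) k ≡ sumTo (λ j → f j * g (k ∸ j)) k
  ⊛-as-sumTo f g k = go k
    where
    go : ∀ i → convAux f g k i ≡ sumTo (λ j → f j * g (k ∸ j)) i
    go zero    = refl
    go (suc i) = cong (_+_ (f (suc i) * g (k ∸ suc i))) (go i)

  ⊛-comm : ∀ f g k → (f ⊛ g) k ≡ (g ⊛ f) k
  ⊛-comm f g k = begin
    (f ⊛ g) k                                   ≡⟨ ⊛-as-sumTo f g k ⟩
    sumTo (λ j → f j * g (k ∸ j)) k             ≡⟨ sumTo-reverse _ k ⟩
    sumTo (λ j → f (k ∸ j) * g (k ∸ (k ∸ j))) k ≡⟨ sumTo-cong k swap ⟩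
    sumTo (λ j → g j * f (k ∸ j)) k             ≡⟨ sym (⊛-as-sumTo g f k) ⟩
    (g ⊛ f) k                                   ∎
    where
    swap : ∀ j → j ≤ k → f (k ∸ j) * g (k ∸ (k ∸ j)) ≡ g j * f (k ∸ j)
    swap j j≤k = trans (ℤP.*-comm (f (k ∸ j)) _) (cong (λ i → g i * f (k ∸ j)) (ℕP.m∸[m∸n]≡n j≤k))

  ⊛-assoc : ∀ f g h k → ((f ⊛ g) ⊛ h) k ≡ (f ⊛ (g ⊛ h)) k
  ⊛-assoc f g h k = begin
    ((f ⊛ g) ⊛ h) k
      ≡⟨ ⊛-as-sumTo (f ⊛ g) h k ⟩
    sumTo (λ a → (f ⊛ g) a * h (k ∸ a)) k
      ≡⟨ sumTo-cong k (λ a _ → trans (cong (_* h (k ∸ a)) (⊛-as-sumTo f g a)) (*-distribʳ-sumTo _ _ a)) ⟩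
    sumTo (λ a → sumTo (λ i → f i * g (a ∸ i) * h (k ∸ a)) a) k
      ≡⟨ sumTo-swap (λ i a → f i * g (a ∸ i) * h (k ∸ a)) k ⟩
    sumTo (λ i → sumTo (λ j → f i * g (i ℕ.+ j ∸ i) * h (k ∸ (i ℕ.+ j))) (k ∸ i)) k
      ≡⟨ sumTo-cong k (λ i _ → sumTo-cong (k ∸ i) (λ j _ → reindex i j)) ⟩
    sumTo (λ i → sumTo (λ j → f i * (g j * h (k ∸ i ∸ j))) (k ∸ i)) k
      ≡⟨ sumTo-cong k (λ i _ → trans (sym (*-distribˡ-sumTo (f i) _ (k ∸ i))) (cong (f i *_) (sym (⊛-as-sumTo g h (k ∸ i))))) ⟩
    sumTo (λ i → f i * (g ⊛ h) (k ∸ i)) k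
      ≡⟨ sym (⊛-as-sumTo f (g ⊛ h) k) ⟩
    (f ⊛ (g ⊛ h)) k ∎
    where
    reindex : ∀ i j → f i * g (i ℕ.+ j ∸ i) * h (k ∸ (i ℕ.+ j)) ≡ f i * (g j * h (k ∸ i ∸ j))
    reindex i j = trans (ℤP.*-assoc (f i) _ _)
      (cong₂ (λ a b → f i * (g a * h b)) (ℕP.m+n∸m≡n i j) (sym (ℕP.∸-+-assoc k i j)))

  constS : ℤ → Series
  constS c zero    = c
  constS c (suc _) = + 0

  constS-⊛ : ∀ c f k → (constS c ⊛ f) k ≡ c * f k
  constS-⊛ c f k = trans (⊛-as-sumTo (constS c) f k) (sumTo-head _ k (λ j → ℤP.*-zeroˡ (f (k ∸ suc j))))

  oneS-⊛ : ∀ f k → (oneS ⊛ f) k ≡ f k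
  oneS-⊛ f k = begin
    (oneS ⊛ f) k        ≡⟨ ⊛-as-sumTo oneS f k ⟩
    sumTo (λ j → oneS j * f (k ∸ j)) k ≡⟨ sumTo-head _ k (λ j → ℤP.*-zeroˡ (f (k ∸ suc j))) ⟩
    + 1 * f k           ≡⟨ ℤP.*-identityˡ (f k) ⟩
    f k                 ∎

  ⊛-cong : ∀ {K f f′ g g′} → f ≡ f′ modT^ K → g ≡ g′ modT^ K → (f ⊛ g) ≡ (f′ ⊛ g′) modT^ K
  ⊛-cong {K} {f} {f′} {g} {g′} f≡f′ g≡g′ k k<K = begin
    (f ⊛ g) k                         ≡⟨ ⊛-as-sumTo f g k ⟩
    sumTo (λ j → f j * g (k ∸ j)) k   ≡⟨ sumTo-cong k (λ j j≤k → cong₂ _*_ (f≡f′ j (below j≤k)) (g≡g′ (k ∸ j) (below (ℕP.m∸n≤m k j)))) ⟩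
    sumTo (λ j → f′ j * g′ (k ∸ j)) k ≡⟨ sym (⊛-as-sumTo f′ g′ k) ⟩
    (f′ ⊛ g′) k                       ∎
    where
    below : ∀ {j} → j ≤ k → j < K
    below j≤k = ℕP.≤-<-trans j≤k k<K

  seriesMonoid : ℕ → CommutativeMonoid 0ℓ 0ℓ
  seriesMonoid K = record
    { Carrier = Series
    ; _≈_     = λ f g → f ≡ g modT^ K
    ; _∙_     = _⊛_
    ; ε       = oneS
    ; isCommutativeMonoid = record
      { isMonoid = record
        { isSemigroup = record
          { isMagma = record
            { isEquivalence = record
              { refl  = λ _ _ → refl
              ; sym   = λ f≡g k k<K → sym (f≡g k k<K)
              ; trans = λ f≡g g≡h k k<K → trans (f≡g k k<K) (g≡h k k<K)
              }
            ; ∙-cong = ⊛-cong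
            }
          ; assoc = λ f g h k _ → ⊛-assoc f g h k
          }
        ; identity = (λ f k _ → oneS-⊛ f k) , (λ f k _ → trans (⊛-comm f oneS k) (oneS-⊛ f k))
        }
      ; comm = λ f g k _ → ⊛-comm f g k
      }
    }

module Primes where

  open import Data.Nat as ℕ using (ℕ; suc; _<_; _>_; _*_; _!; z≤n; s≤s)
  import Data.Nat.Properties as ℕP
  open import Data.Nat.Divisibility using (_∣_; ∣-refl; ∣-trans; ∣m⇒∣m*n; *-monoʳ-∣; ∣1⇒≡1)
  open import Data.Nat.ListAction using (product)
  open import Data.Nat.Primality
  open import Data.Nat.Primality.Factorisation using (factorise)
  open import Data.Nat.GCD using (gcd; gcd[m,n]∣m; gcd[m,n]∣n; gcd-greatest; c*gcd[m,n]≡gcd[cm,cn])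
  open import Data.Nat.Coprimality using (Coprime; coprime-divisor)
  open import Data.List using ([]; _∷_)
  open import Data.List.Relation.Unary.All using (All; _∷_)
  open import Data.Product using (∃-syntax; _×_; _,_)
  open import Data.Sum using (inj₁; inj₂)
  open import Data.Empty using (⊥-elim)
  open import Relation.Nullary using (¬_)
  open import Relation.Binary.PropositionalEquality

  prime>0 : ∀ {p} → Prime p → p > 0
  prime>0 {suc _} _ = s≤s z≤n

  prime>1 : ∀ {p} → Prime p → p > 1
  prime>1 {p} pp = ℕ.nonTrivial⇒n>1 p {{prime⇒nonTrivial pp}}

  n∣n! : ∀ {n} → 0 < n → n ∣ n !
  n∣n! {suc n} _ = ∣m⇒∣m*n (n !) ∣-refl

  prime∤1 : ∀ {p} → Prime p → ¬ p ∣ 1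
  prime∤1 pp p∣1 = ℕP.<⇒≢ (prime>1 pp) (sym (∣1⇒≡1 p∣1))

  prime∤prime : ∀ {p r} → Prime p → Prime r → p ≢ r → ¬ p ∣ r
  prime∤prime pp pr p≢r p∣r with prime⇒irreducible pr p∣r
  ... | inj₁ p≡1 = prime∤1 pp (subst (_∣ 1) (sym p≡1) ∣-refl)
  ... | inj₂ p≡r = p≢r p≡r

  prime∤* : ∀ {p m n} → Prime p → ¬ p ∣ m → ¬ p ∣ n → ¬ p ∣ m * n
  prime∤* {m = m} {n} pp p∤m p∤n p∣mn with euclidsLemma m n pp p∣mn
  ... | inj₁ p∣m = p∤m p∣m
  ... | inj₂ p∣n = p∤n p∣n

  primeFactor : ∀ n → n > 1 → ∃[ q ] Prime q × q ∣ n
  primeFactor n n>1 with factorise n {{ℕ.>-nonZero (ℕP.<-trans (s≤s z≤n) n>1)}}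
  ... | record { factors = [] ; isFactorisation = n≡1 } = ⊥-elim (ℕP.<⇒≢ n>1 (sym n≡1))
  ... | record { factors = q ∷ qs ; isFactorisation = n≡q∏qs ; factorsPrime = pq ∷ _ } =
    q , pq , subst (q ∣_) (sym n≡q∏qs) (∣m⇒∣m*n (product qs) ∣-refl)

  ∣-drop-prime : ∀ {t d P p w} → Prime p → ¬ p ∣ P → t ∣ d * P → t ∣ d * p * w → t ∣ d * w
  ∣-drop-prime {t} {d} {P} {p} {w} pp p∤P t∣dP t∣dpw = ∣-trans t∣d*gcd (*-monoʳ-∣ d gcd∣w)
    where
    g : ℕ
    g = gcd (p * w) P
    t∣d*gcd : t ∣ d * g
    t∣d*gcd = subst (t ∣_) (sym (c*gcd[m,n]≡gcd[cm,cn] d (p * w) P)) (gcd-greatest (subst (t ∣_) (ℕP.*-assoc d p w) t∣dpw) t∣dP)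
    coprime : Coprime g p
    coprime (i∣g , i∣p) with prime⇒irreducible pp i∣p
    ... | inj₁ i≡1 = i≡1
    ... | inj₂ refl = ⊥-elim (p∤P (∣-trans i∣g (gcd[m,n]∣n (p * w) P)))
    gcd∣w : g ∣ w
    gcd∣w = coprime-divisor coprime (gcd[m,n]∣m (p * w) P)

  *-productOfPrimes>0 : ∀ {z R} → 0 < z → All Prime R → 0 < z * product R
  *-productOfPrimes>0 0<z pR = ℕP.*-mono-≤ 0<z (productOfPrimes≥1 pR)

module FullDivisors where

  open import Defs using (divisors)
  open Primes
  open import Data.Nat as ℕ using (ℕ; suc; _≟_; _≤_; _<_; _*_; s≤s; _≤′_; ≤′-refl; ≤′-step)
  import Data.Nat.Properties as ℕP
  open import Data.Nat.Divisibility
  open import Data.Nat.ListAction using (product)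
  open import Data.Nat.Primality using (Prime; euclidsLemma; prime⇒nonZero)
  open import Data.Nat.Primality.Factorisation using (factorisationHasAllPrimeFactors)
  open import Data.List using (List; []; _∷_; _++_; [_]; map; upTo; filter)
  open import Data.List.Properties using (upTo-∷ʳ; map-++; map-upTo; filter-++; filter-reject; filter-accept; filter-none; filter-≐; ++-identityʳ)
  open import Data.List.Relation.Unary.All as All using (All; []; _∷_)
  open import Data.List.Relation.Unary.All.Properties using (applyUpTo⁺₁)
  open import Data.List.Relation.Unary.Any using (here; there)
  open import Data.List.Membership.Propositional using (_∈_)
  open import Data.Product using (∃-syntax; _×_; _,_; proj₁; proj₂; assocʳ; assocˡ)
  open import Data.Sum using (inj₁; inj₂)
  open import Data.Unit using (⊤; tt)
  open import Data.Empty using (⊥-elim)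
  open import Relation.Nullary using (¬_; yes; no)
  open import Relation.Unary using (Pred; Decidable; ∁; _∩_)
  open import Relation.Unary.Properties using (∁?; _∩?_)
  open import Relation.Binary.PropositionalEquality hiding ([_])
  open import Level using (0ℓ)
  open import Data.Nat.Tactic.RingSolver using (solve-∀)

  open ≡-Reasoning

  [1‥_] : ℕ → List ℕ
  [1‥ n ] = map suc (upTo n)

  [1‥suc] : ∀ n → [1‥ suc n ] ≡ [1‥ n ] ++ [ suc n ]
  [1‥suc] n = trans (cong (map suc) (sym (upTo-∷ʳ n))) (map-++ suc (upTo n) [ n ])

  [1‥]-bounded : ∀ n → All (_≤ n) [1‥ n ]
  [1‥]-bounded n = subst (All (_≤ n)) (sym (map-upTo suc n)) (applyUpTo⁺₁ suc n (λ i<n → i<n))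

  filter-[1‥]-beyond : ∀ {P : Pred ℕ 0ℓ} (P? : Decidable P) {x y} → (∀ e → y < e → ¬ P e) → y ≤ x →
    filter P? [1‥ x ] ≡ filter P? [1‥ y ]
  filter-[1‥]-beyond P? {y = y} ¬P y≤x = go (ℕP.≤⇒≤′ y≤x)
    where
    go : ∀ {x} → y ≤′ x → filter P? [1‥ x ] ≡ filter P? [1‥ y ]
    go ≤′-refl = refl
    go (≤′-step {x} y≤′x) = begin
      filter P? [1‥ suc x ]                          ≡⟨ cong (filter P?) ([1‥suc] x) ⟩
      filter P? ([1‥ x ] ++ [ suc x ])               ≡⟨ filter-++ P? [1‥ x ] [ suc x ] ⟩
      filter P? [1‥ x ] ++ filter P? [ suc x ]       ≡⟨ cong (filter P? [1‥ x ] ++_) (filter-reject P? (¬P (suc x) (s≤s (ℕP.≤′⇒≤ y≤′x)))) ⟩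
      filter P? [1‥ x ] ++ []                        ≡⟨ ++-identityʳ _ ⟩
      filter P? [1‥ x ]                              ≡⟨ go y≤′x ⟩
      filter P? [1‥ y ]                              ∎

  filter-filter : ∀ {a p q} {A : Set a} {P : Pred A p} {Q : Pred A q} (P? : Decidable P) (Q? : Decidable Q) xs →
    filter P? (filter Q? xs) ≡ filter (Q? ∩? P?) xs
  filter-filter P? Q? []       = refl
  filter-filter P? Q? (x ∷ xs) with Q? x
  ... | no ¬q = filter-filter P? Q? xs
  ... | yes q with P? x
  ...   | yes p = cong (x ∷_) (filter-filter P? Q? xs)
  ...   | no ¬p = filter-filter P? Q? xs

  PrimeDivisorsIn : ℕ → List ℕ → Set
  PrimeDivisorsIn z R = ∀ {q} → Prime q → q ∣ z → q ∈ R

  -- e is full in n = z * ∏ R when it divides none of the n / r with r ∈ R.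
  IsFull : List ℕ → ℕ → Pred ℕ 0ℓ
  IsFull []      z = λ _ → ⊤
  IsFull (r ∷ R) z = IsFull R (z * r) ∩ ∁ (_∣ z * product R)

  isFull? : ∀ R z → Decidable (IsFull R z)
  isFull? []      z _ = yes tt
  isFull? (r ∷ R) z   = isFull? R (z * r) ∩? ∁? (_∣? z * product R)

  fullDivisors : List ℕ → ℕ → List ℕ
  fullDivisors R z = filter (isFull? R z) (divisors (z * product R))

  IsFull-*ʳ⁻ : ∀ R {z r e} → IsFull R (z * r) e → IsFull R z e
  IsFull-*ʳ⁻ []       _ = tt
  IsFull-*ʳ⁻ (r′ ∷ R) {z} {r} {e} (full , e∤zr∏R) =
    IsFull-*ʳ⁻ R (subst (λ x → IsFull R x e) (zrr′≡zr′r z r r′) full) ,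
    λ e∣z∏R → e∤zr∏R (subst (e ∣_) (z∏Rr≡zr∏R z r (product R)) (∣m⇒∣m*n r e∣z∏R))
    where
    zrr′≡zr′r : ∀ z r r′ → z * r * r′ ≡ z * r′ * r
    zrr′≡zr′r = solve-∀
    z∏Rr≡zr∏R : ∀ z r P → z * P * r ≡ z * r * P
    z∏Rr≡zr∏R = solve-∀

  IsFull-*ʳ⁺ : ∀ R {z r e} → Prime r → All Prime R → All (r ≢_) R → e ∣ z * product R →
    IsFull R z e → IsFull R (z * r) e
  IsFull-*ʳ⁺ []       _  _           _            _     _ = tt
  IsFull-*ʳ⁺ (r′ ∷ R) {z} {r} {e} pr (pr′ ∷ pR) (r≢r′ ∷ r∉R) e∣zr′∏R (full , e∤z∏R) =
    subst (λ x → IsFull R x e) (zr′r≡zrr′ z r′ r) (IsFull-*ʳ⁺ R pr pR r∉R (subst (e ∣_) (sym (ℕP.*-assoc z r′ (product R))) e∣zr′∏R) full) ,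
    λ e∣zr∏R → e∤z∏R (subst (e ∣_) (ℕP.*-identityʳ _) (∣-drop-prime {d = z * product R} {w = 1} pr (prime∤prime pr pr′ r≢r′)
      (subst (e ∣_) (zr∏R≡z∏Rr z r′ (product R)) e∣zr′∏R)
      (subst (e ∣_) (zr∏R≡z∏R*r*1 z r (product R)) e∣zr∏R)))
    where
    zr′r≡zrr′ : ∀ z r′ r → z * r′ * r ≡ z * r * r′
    zr′r≡zrr′ = solve-∀
    zr∏R≡z∏Rr : ∀ z r P → z * (r * P) ≡ z * P * r
    zr∏R≡z∏Rr = solve-∀
    zr∏R≡z∏R*r*1 : ∀ z r P → z * r * P ≡ z * P * r * 1
    zr∏R≡z∏R*r*1 = solve-∀

  filter-fullDivisors : ∀ {P : Pred ℕ 0ℓ} (P? : Decidable P) R z →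
    filter P? (fullDivisors R z) ≡ filter (((_∣? z * product R) ∩? isFull? R z) ∩? P?) [1‥ z * product R ]
  filter-fullDivisors P? R z = begin
    filter P? (filter (isFull? R z) (filter (_∣? n) [1‥ n ]))
      ≡⟨ cong (filter P?) (filter-filter (isFull? R z) (_∣? n) [1‥ n ]) ⟩
    filter P? (filter ((_∣? n) ∩? isFull? R z) [1‥ n ])
      ≡⟨ filter-filter P? ((_∣? n) ∩? isFull? R z) [1‥ n ] ⟩
    filter (((_∣? n) ∩? isFull? R z) ∩? P?) [1‥ n ] ∎
    where
    n : ℕ
    n = z * product R

  fullDivisors-∣ : ∀ R {z r} → 0 < z → Prime r → All Prime R → All (r ≢_) R →
    filter (_∣? z * product R) (fullDivisors R (z * r)) ≡ fullDivisors R z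
  fullDivisors-∣ R {z} {r} 0<z pr pR r∉R = begin
    filter (_∣? zP) (fullDivisors R (z * r))
      ≡⟨ filter-fullDivisors (_∣? zP) R (z * r) ⟩
    filter (((_∣? zrP) ∩? isFull? R (z * r)) ∩? (_∣? zP)) [1‥ zrP ]
      ≡⟨ filter-≐ _ ((_∣? zP) ∩? isFull? R z) (to , from) [1‥ zrP ] ⟩
    filter ((_∣? zP) ∩? isFull? R z) [1‥ zrP ]
      ≡⟨ filter-[1‥]-beyond _ (λ _ zP<e (e∣zP , _) → >⇒∤ {{ℕ.>-nonZero 0<zP}} zP<e e∣zP) (∣⇒≤ {{ℕ.>-nonZero 0<zrP}} zP∣zrP) ⟩
    filter ((_∣? zP) ∩? isFull? R z) [1‥ zP ]
      ≡⟨ filter-filter (isFull? R z) (_∣? zP) [1‥ zP ] ⟨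
    fullDivisors R z ∎
    where
    zP zrP : ℕ
    zP  = z * product R
    zrP = z * r * product R
    0<zP : 0 < zP
    0<zP = *-productOfPrimes>0 0<z pR
    0<zrP : 0 < zrP
    0<zrP = *-productOfPrimes>0 (ℕP.*-mono-≤ 0<z (prime>0 pr)) pR
    zP∣zrP : zP ∣ zrP
    zP∣zrP = divides r (zr∏R≡r*z∏R z r (product R))
      where
      zr∏R≡r*z∏R : ∀ z r P → z * r * P ≡ r * (z * P)
      zr∏R≡r*z∏R = solve-∀
    to : ∀ {e} → (e ∣ zrP × IsFull R (z * r) e) × e ∣ zP → e ∣ zP × IsFull R z e
    to ((_ , full) , e∣zP) = e∣zP , IsFull-*ʳ⁻ R full
    from : ∀ {e} → e ∣ zP × IsFull R z e → (e ∣ zrP × IsFull R (z * r) e) × e ∣ zP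
    from (e∣zP , full) = (∣-trans e∣zP zP∣zrP , IsFull-*ʳ⁺ R pr pR r∉R e∣zP full) , e∣zP

  fullDivisors-∤ : ∀ R z r → filter (∁? (_∣? z * product R)) (fullDivisors R (z * r)) ≡ fullDivisors (r ∷ R) z
  fullDivisors-∤ R z r = begin
    filter (∁? (_∣? zP)) (fullDivisors R (z * r))
      ≡⟨ filter-fullDivisors (∁? (_∣? zP)) R (z * r) ⟩
    filter (((_∣? zrP) ∩? isFull? R (z * r)) ∩? ∁? (_∣? zP)) [1‥ zrP ]
      ≡⟨ filter-≐ _ ((_∣? zrP) ∩? isFull? (r ∷ R) z) (assocʳ , assocˡ) [1‥ zrP ] ⟩
    filter ((_∣? zrP) ∩? isFull? (r ∷ R) z) [1‥ zrP ]
      ≡⟨ filter-filter (isFull? (r ∷ R) z) (_∣? zrP) [1‥ zrP ] ⟨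
    filter (isFull? (r ∷ R) z) (divisors zrP)
      ≡⟨ cong (λ n → filter (isFull? (r ∷ R) z) (divisors n)) (ℕP.*-assoc z r (product R)) ⟩
    fullDivisors (r ∷ R) z ∎
    where
    zP zrP : ℕ
    zP  = z * product R
    zrP = z * r * product R

  IsFull-self : ∀ R {z} → 0 < z → All Prime R → IsFull R z (z * product R)
  IsFull-self []                   _   _          = tt
  IsFull-self (r ∷ R) {z} 0<z (pr ∷ pR) =
    subst (IsFull R (z * r)) (ℕP.*-assoc z r (product R)) (IsFull-self R (ℕP.*-mono-≤ 0<z (prime>0 pr)) pR) ,
    >⇒∤ {{ℕ.>-nonZero 0<zP}} zP<zrP
    where
    0<zP : 0 < z * product R
    0<zP = *-productOfPrimes>0 0<z pR
    zP<zrP : z * product R < z * (r * product R)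
    zP<zrP = subst (z * product R <_) (z∏Rr≡zr∏R z r (product R)) (ℕP.m<m*n _ r {{ℕ.>-nonZero 0<zP}} (prime>1 pr))
      where
      z∏Rr≡zr∏R : ∀ z r P → z * P * r ≡ z * (r * P)
      z∏Rr≡zr∏R = solve-∀

  IsFull-elim : ∀ R {z e q} → All Prime R → IsFull R z e → q ∈ R → ¬ e * q ∣ z * product R
  IsFull-elim (r ∷ R) {z} {e} (pr ∷ _) (_ , e∤z∏R) (here refl) er∣zr∏R =
    e∤z∏R (*-cancelʳ-∣ r {{prime⇒nonZero pr}} (subst (e * r ∣_) (zr∏R≡z∏Rr z r (product R)) er∣zr∏R))
    where
    zr∏R≡z∏Rr : ∀ z r P → z * (r * P) ≡ z * P * r
    zr∏R≡z∏Rr = solve-∀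
  IsFull-elim (r ∷ R) {z} {e} {q} (_ ∷ pR) (full , _) (there q∈R) eq∣zr∏R =
    IsFull-elim R pR full q∈R (subst (e * q ∣_) (sym (ℕP.*-assoc z r (product R))) eq∣zr∏R)

  PrimeDivisorsIn-* : ∀ {z R} → All Prime R → PrimeDivisorsIn z R → PrimeDivisorsIn (z * product R) R
  PrimeDivisorsIn-* {z} {R} pR z⊆R pq q∣z∏R with euclidsLemma z (product R) pq q∣z∏R
  ... | inj₁ q∣z  = z⊆R pq q∣z
  ... | inj₂ q∣∏R = factorisationHasAllPrimeFactors pq q∣∏R pR

  IsFull⇒self : ∀ R {z e} → 0 < z → All Prime R → PrimeDivisorsIn z R →
    e ∣ z * product R → IsFull R z e → e ≡ z * product R
  IsFull⇒self R {z} {e} 0<z pR z⊆R e∣n full with e ≟ z * product R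
  ... | yes e≡n = e≡n
  ... | no  e≢n = ⊥-elim (IsFull-elim R pR full q∈R eq∣n)
    where
    factor : ∃[ q ] Prime q × q ∣ quotient e∣n
    factor = primeFactor (quotient e∣n) (quotient>1 e∣n (ℕP.≤∧≢⇒< (∣⇒≤ {{ℕ.>-nonZero (*-productOfPrimes>0 0<z pR)}} e∣n) e≢n))
    q : ℕ
    q = proj₁ factor
    q*e∣n : q * e ∣ z * product R
    q*e∣n = subst (q * e ∣_) (sym (m∣n⇒n≡quotient*m e∣n)) (*-monoˡ-∣ e (proj₂ (proj₂ factor)))
    q∈R : q ∈ R
    q∈R = PrimeDivisorsIn-* pR z⊆R (proj₁ (proj₂ factor)) (∣-trans (∣m⇒∣m*n e ∣-refl) q*e∣n)
    eq∣n : e * q ∣ z * product R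
    eq∣n = subst (_∣ z * product R) (ℕP.*-comm q e) q*e∣n

  filter-≟-[1‥] : ∀ {n} → 0 < n → filter (_≟ n) [1‥ n ] ≡ [ n ]
  filter-≟-[1‥] {suc n} _ = begin
    filter (_≟ suc n) [1‥ suc n ]                              ≡⟨ cong (filter (_≟ suc n)) ([1‥suc] n) ⟩
    filter (_≟ suc n) ([1‥ n ] ++ [ suc n ])                   ≡⟨ filter-++ (_≟ suc n) [1‥ n ] [ suc n ] ⟩
    filter (_≟ suc n) [1‥ n ] ++ filter (_≟ suc n) [ suc n ]  ≡⟨ cong₂ _++_ below (filter-accept (_≟ suc n) refl) ⟩
    [ suc n ]                                                  ∎
    where
    below : filter (_≟ suc n) [1‥ n ] ≡ []
    below = filter-none (_≟ suc n) (All.map (λ e≤n → ℕP.<⇒≢ (s≤s e≤n)) ([1‥]-bounded n))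

  fullDivisors-self : ∀ R {z} → 0 < z → All Prime R → PrimeDivisorsIn z R → fullDivisors R z ≡ [ z * product R ]
  fullDivisors-self R {z} 0<z pR z⊆R = begin
    filter (isFull? R z) (filter (_∣? n) [1‥ n ]) ≡⟨ filter-filter (isFull? R z) (_∣? n) [1‥ n ] ⟩
    filter ((_∣? n) ∩? isFull? R z) [1‥ n ]       ≡⟨ filter-≐ _ (_≟ n) (only-self , self) [1‥ n ] ⟩
    filter (_≟ n) [1‥ n ]                         ≡⟨ filter-≟-[1‥] (*-productOfPrimes>0 0<z pR) ⟩
    [ n ]                                         ∎
    where
    n : ℕ
    n = z * product R
    only-self : ∀ {e} → e ∣ n × IsFull R z e → e ≡ n
    only-self (e∣n , full) = IsFull⇒self R 0<z pR z⊆R e∣n full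
    self : ∀ {e} → e ≡ n → e ∣ n × IsFull R z e
    self refl = ∣-refl , IsFull-self R 0<z pR

module InclusionExclusion {c ℓ} (M : CommutativeMonoid c ℓ) where

  open import Data.Nat as ℕ using (ℕ; _≤_; _*_)
  import Data.Nat.Properties as ℕP
  open import Data.Nat.Divisibility using (_∣_; ∣-refl; ∣-trans; ∣m⇒∣m*n)
  open import Data.Nat.Primality using (Prime)
  open import Data.Nat.ListAction using (product)
  open import Data.List using (List; []; _∷_)
  open import Data.List.Relation.Unary.All as All using (All; []; _∷_)
  open import Data.List.Relation.Unary.AllPairs using (_∷_)
  open import Data.List.Relation.Unary.Unique.Propositional using (Unique)
  open import Data.List.Relation.Unary.Any using (here; there)
  open import Data.List.Membership.Propositional using (_∈_)
  open import Data.Product using (_×_; _,_; proj₁; proj₂; swap)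
  open import Data.Sum using (_⊎_; inj₁; inj₂)
  open import Relation.Nullary using (¬_)
  open import Relation.Binary.PropositionalEquality as ≡ using (_≡_; _≢_)
  open import Data.Nat.Tactic.RingSolver using (solve-∀)
  open Primes using (prime∤1; prime∤prime; prime∤*)

  open CommutativeMonoid M
  open import Algebra.Properties.CommutativeSemigroup commutativeSemigroup using (interchange; x∙yz≈y∙xz)
  open import Relation.Binary.Reasoning.Setoid setoid

  -- ∏even G R z is the product of G (z * ∏ S) over the S ⊆ R with |R ∖ S| even, ∏odd the same
  -- over |R ∖ S| odd; for distinct primes R and n = z * ∏ R these are the G (n / e), e ∣ ∏ R,
  -- with μ(e) = 1, resp. μ(e) = -1.
  mutual
    ∏even : (ℕ → Carrier) → List ℕ → ℕ → Carrier
    ∏even G []      z = G z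
    ∏even G (r ∷ R) z = ∏even G R (z * r) ∙ ∏odd G R z

    ∏odd : (ℕ → Carrier) → List ℕ → ℕ → Carrier
    ∏odd G []      z = ε
    ∏odd G (r ∷ R) z = ∏odd G R (z * r) ∙ ∏even G R z

  ∏even-∏odd-cong : ∀ {G G′} R z → (∀ y → y ∣ z * product R → G y ≈ G′ y) →
    ∏even G R z ≈ ∏even G′ R z × ∏odd G R z ≈ ∏odd G′ R z
  ∏even-∏odd-cong []      z G≈G′ = G≈G′ z (∣m⇒∣m*n 1 ∣-refl) , refl
  ∏even-∏odd-cong (r ∷ R) z G≈G′ =
    let (even₁ , odd₁) = ∏even-∏odd-cong R (z * r) (λ y y∣ → G≈G′ y (≡.subst (y ∣_) (ℕP.*-assoc z r (product R)) y∣))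
        (even₀ , odd₀) = ∏even-∏odd-cong R z (λ y y∣ → G≈G′ y (∣-trans y∣ z∏R∣z∏rR))
    in ∙-cong even₁ odd₀ , ∙-cong odd₁ even₀
    where
    z∏R∣z∏rR : z * product R ∣ z * (r * product R)
    z∏R∣z∏rR = ≡.subst (z * product R ∣_)
      (≡.trans (ℕP.*-assoc z (product R) r) (≡.cong (z *_) (ℕP.*-comm (product R) r))) (∣m⇒∣m*n r ∣-refl)

  ∏even-∏odd-ε : ∀ R z → ∏even (λ _ → ε) R z ≈ ε × ∏odd (λ _ → ε) R z ≈ ε
  ∏even-∏odd-ε []      z = refl , refl
  ∏even-∏odd-ε (r ∷ R) z =
    let (even₁ , odd₁) = ∏even-∏odd-ε R (z * r)
        (even₀ , odd₀) = ∏even-∏odd-ε R z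
    in trans (∙-cong even₁ odd₀) (identityˡ ε) , trans (∙-cong odd₁ even₀) (identityˡ ε)

  ∏even-∏odd-∙ : ∀ G H R z →
    ∏even (λ w → G w ∙ H w) R z ≈ ∏even G R z ∙ ∏even H R z ×
    ∏odd (λ w → G w ∙ H w) R z ≈ ∏odd G R z ∙ ∏odd H R z
  ∏even-∏odd-∙ G H []      z = refl , sym (identityˡ ε)
  ∏even-∏odd-∙ G H (r ∷ R) z =
    let (even₁ , odd₁) = ∏even-∏odd-∙ G H R (z * r)
        (even₀ , odd₀) = ∏even-∏odd-∙ G H R z
    in trans (∙-cong even₁ odd₀) (interchange _ _ _ _) , trans (∙-cong odd₁ even₀) (interchange _ _ _ _)

  ∏even-∏odd-const : ∀ u R z z′ → ∏even (λ _ → u) R z ≡ ∏even (λ _ → u) R z′ × ∏odd (λ _ → u) R z ≡ ∏odd (λ _ → u) R z′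
  ∏even-∏odd-const u []      z z′ = ≡.refl , ≡.refl
  ∏even-∏odd-const u (r ∷ R) z z′ =
    let (even₁ , odd₁) = ∏even-∏odd-const u R (z * r) (z′ * r)
        (even₀ , odd₀) = ∏even-∏odd-const u R z z′
    in ≡.cong₂ _∙_ even₁ odd₀ , ≡.cong₂ _∙_ odd₁ even₀

  ∏even≈∏odd-const : ∀ u r R z → ∏even (λ _ → u) (r ∷ R) z ≈ ∏odd (λ _ → u) (r ∷ R) z
  ∏even≈∏odd-const u r R z = begin
    ∏even (λ _ → u) R (z * r) ∙ ∏odd (λ _ → u) R z ≡⟨ ≡.cong (_∙ _) (proj₁ (∏even-∏odd-const u R (z * r) z)) ⟩
    ∏even (λ _ → u) R z ∙ ∏odd (λ _ → u) R z       ≈⟨ comm _ _ ⟩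
    ∏odd (λ _ → u) R z ∙ ∏even (λ _ → u) R z       ≡⟨ ≡.cong (_∙ _) (proj₂ (∏even-∏odd-const u R (z * r) z)) ⟨
    ∏odd (λ _ → u) R (z * r) ∙ ∏even (λ _ → u) R z ∎

  ∏even-∏odd-vanish : ∀ {G K} → (∀ w → K ≤ w → G w ≈ ε) →
    ∀ R z → K ≤ z → All (1 ≤_) R → ∏even G R z ≈ ε × ∏odd G R z ≈ ε
  ∏even-∏odd-vanish G≈ε []      z K≤z []           = G≈ε z K≤z , refl
  ∏even-∏odd-vanish G≈ε (r ∷ R) z K≤z (1≤r ∷ 1≤R) =
    let (even₁ , odd₁) = ∏even-∏odd-vanish G≈ε R (z * r) (ℕP.≤-trans K≤z (ℕP.m≤m*n z r)) 1≤R
        (even₀ , odd₀) = ∏even-∏odd-vanish G≈ε R z K≤z 1≤R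
    in trans (∙-cong even₁ odd₀) (identityˡ ε) , trans (∙-cong odd₁ even₀) (identityˡ ε)
    where instance _ = ℕ.>-nonZero 1≤r

  parityPair : List ℕ → Carrier → Carrier × Carrier
  parityPair []      g = g , ε
  parityPair (_ ∷ R) g = swap (parityPair R g)

  ∏even-∏odd-parityPair : ∀ {G d} → (∀ w → 2 * d ≤ w → G w ≈ ε) → ∀ R → All (2 ≤_) R →
    ∏even G R d ≈ proj₁ (parityPair R (G d)) × ∏odd G R d ≈ proj₂ (parityPair R (G d))
  ∏even-∏odd-parityPair G≈ε []      []           = refl , refl
  ∏even-∏odd-parityPair {G} {d} G≈ε (r ∷ R) (2≤r ∷ 2≤R) =
    let (even₁ , odd₁) = ∏even-∏odd-vanish G≈ε R (d * r) 2d≤dr (All.map (ℕP.≤-trans (ℕP.n≤1+n 1)) 2≤R)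
        (even₀ , odd₀) = ∏even-∏odd-parityPair G≈ε R 2≤R
    in trans (∙-cong even₁ odd₀) (identityˡ _) , trans (∙-cong odd₁ even₀) (identityˡ _)
    where
    2d≤dr : 2 * d ≤ d * r
    2d≤dr = ℕP.≤-trans (ℕP.≤-reflexive (ℕP.*-comm 2 d)) (ℕP.*-monoʳ-≤ d 2≤r)

  parityPair-cases : ∀ R g → parityPair R g ≡ (g , ε) ⊎ parityPair R g ≡ (ε , g)
  parityPair-cases []      g = inj₁ ≡.refl
  parityPair-cases (_ ∷ R) g with parityPair-cases R g
  ... | inj₁ pp≡ = inj₂ (≡.cong swap pp≡)
  ... | inj₂ pp≡ = inj₁ (≡.cong swap pp≡)

  parityPair-trivial : ∀ R g → ε ∙ proj₂ (parityPair R g) ≈ proj₁ (parityPair R g) → g ≈ ε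
  parityPair-trivial R g ε∙snd≈fst with parityPair-cases R g
  ... | inj₁ pp≡ = sym (trans (sym (identityʳ ε)) (≡.subst (λ p → ε ∙ proj₂ p ≈ proj₁ p) pp≡ ε∙snd≈fst))
  ... | inj₂ pp≡ = trans (sym (identityˡ g)) (≡.subst (λ p → ε ∙ proj₂ p ≈ proj₁ p) pp≡ ε∙snd≈fst)

  -- Twisting G by the involution u leaves the relation X ∙ ∏odd ≈ ∏even intact,
  -- since for R ≢ [] both products pick up the same power of u; after the twist
  -- every factor but the one at z = d is trivial.
  module _ {u : Carrier} (u∙u≈ε : u ∙ u ≈ ε) {G : ℕ → Carrier} {d : ℕ} (G≈u : ∀ w → 2 * d ≤ w → G w ≈ u) where

    ∏even-∏odd-reduce : ∀ r R → All (2 ≤_) (r ∷ R) → ∀ X → X ∙ ∏odd G (r ∷ R) d ≈ ∏even G (r ∷ R) d →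
      X ∙ proj₂ (parityPair (r ∷ R) (u ∙ G d)) ≈ proj₁ (parityPair (r ∷ R) (u ∙ G d))
    ∏even-∏odd-reduce r R 2≤R X X∙odd≈even = begin
      X ∙ proj₂ (parityPair (r ∷ R) (u ∙ G d)) ≈⟨ ∙-congˡ (sym (proj₂ twisted)) ⟩
      X ∙ ∏odd uG (r ∷ R) d                     ≈⟨ ∙-congˡ (proj₂ (∏even-∏odd-∙ (λ _ → u) G (r ∷ R) d)) ⟩
      X ∙ (Uodd ∙ ∏odd G (r ∷ R) d)             ≈⟨ x∙yz≈y∙xz X Uodd _ ⟩
      Uodd ∙ (X ∙ ∏odd G (r ∷ R) d)             ≈⟨ ∙-cong (sym (∏even≈∏odd-const u r R d)) X∙odd≈even ⟩
      Ueven ∙ ∏even G (r ∷ R) d                 ≈⟨ proj₁ (∏even-∏odd-∙ (λ _ → u) G (r ∷ R) d) ⟨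
      ∏even uG (r ∷ R) d                        ≈⟨ proj₁ twisted ⟩
      proj₁ (parityPair (r ∷ R) (u ∙ G d))      ∎
      where
      uG : ℕ → Carrier
      uG w = u ∙ G w
      Ueven Uodd : Carrier
      Ueven = ∏even (λ _ → u) (r ∷ R) d
      Uodd  = ∏odd (λ _ → u) (r ∷ R) d
      twisted : ∏even uG (r ∷ R) d ≈ proj₁ (parityPair (r ∷ R) (uG d)) × ∏odd uG (r ∷ R) d ≈ proj₂ (parityPair (r ∷ R) (uG d))
      twisted = ∏even-∏odd-parityPair (λ w 2d≤w → trans (∙-congˡ (G≈u w 2d≤w)) u∙u≈ε) (r ∷ R) 2≤R

  IgnoresFactor : ℕ → (ℕ → Carrier) → ℕ → Set ℓ
  IgnoresFactor p G z = ∀ w → ¬ p ∣ w → G (z * p * w) ≈ G (z * w)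

  IgnoresFactor-* : ∀ {p r G z} → Prime p → Prime r → p ≢ r → IgnoresFactor p G z → IgnoresFactor p G (z * r)
  IgnoresFactor-* {p} {r} {G} {z} pp pr p≢r ignores w p∤w = begin
    G (z * r * p * w)   ≡⟨ ≡.cong G (zrpw≡zp[rw] z r p w) ⟩
    G (z * p * (r * w)) ≈⟨ ignores (r * w) (prime∤* pp (prime∤prime pp pr p≢r) p∤w) ⟩
    G (z * (r * w))     ≡⟨ ≡.cong G (ℕP.*-assoc z r w) ⟨
    G (z * r * w)       ∎
    where
    zrpw≡zp[rw] : ∀ z r p w → z * r * p * w ≡ z * p * (r * w)
    zrpw≡zp[rw] = solve-∀

  ∏even-∏odd-*-ignored : ∀ {p G} R z → Prime p → All Prime R → All (p ≢_) R → IgnoresFactor p G z →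
    ∏even G R (z * p) ≈ ∏even G R z × ∏odd G R (z * p) ≈ ∏odd G R z
  ∏even-∏odd-*-ignored {p} {G} []      z pp []         []           ignores =
    trans (reflexive (≡.cong G (≡.sym (ℕP.*-identityʳ (z * p))))) (trans (ignores 1 (prime∤1 pp)) (reflexive (≡.cong G (ℕP.*-identityʳ z)))) ,
    refl
  ∏even-∏odd-*-ignored {p} {G} (r ∷ R) z pp (pr ∷ pR) (p≢r ∷ p∉R) ignores =
    let (even₁ , odd₁) = ∏even-∏odd-*-ignored R (z * r) pp pR p∉R (IgnoresFactor-* {G = G} {z} pp pr p≢r ignores)
        (even₀ , odd₀) = ∏even-∏odd-*-ignored R z pp pR p∉R ignores
    in ∙-cong (trans (reflexive (≡.cong (∏even G R) (zpr≡zrp z p r))) even₁) odd₀ ,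
       ∙-cong (trans (reflexive (≡.cong (∏odd G R) (zpr≡zrp z p r))) odd₁) even₀
    where
    zpr≡zrp : ∀ z p r → z * p * r ≡ z * r * p
    zpr≡zrp = solve-∀

  ∏even≈∏odd-ignored : ∀ {p G} R z → p ∈ R → All Prime R → Unique R → IgnoresFactor p G z →
    ∏even G R z ≈ ∏odd G R z
  ∏even≈∏odd-ignored {G = G} (p ∷ R) z (here ≡.refl) (pp ∷ pR) (p∉R ∷ _) ignores =
    let (even₁ , odd₁) = ∏even-∏odd-*-ignored R z pp pR p∉R ignores
    in trans (∙-congʳ even₁) (trans (comm _ _) (∙-congʳ (sym odd₁)))
  ∏even≈∏odd-ignored {p} {G} (r ∷ R) z (there p∈R) (pr ∷ pR) (r∉R ∷ unique) ignores =
    ∙-cong (∏even≈∏odd-ignored R (z * r) p∈R pR unique (IgnoresFactor-* {G = G} {z} (All.lookup pR p∈R) pr p≢r ignores))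
           (sym (∏even≈∏odd-ignored R z p∈R pR unique ignores))
    where
    p≢r : p ≢ r
    p≢r ≡.refl = All.lookup r∉R p∈R ≡.refl

module Möbius {c ℓ} (M : CommutativeMonoid c ℓ) where

  open import Defs using (divisors)
  open FullDivisors
  open InclusionExclusion M
  open Primes using (prime>0)
  open import Data.Nat using (ℕ; _<_; _*_)
  import Data.Nat.Properties as ℕP
  open import Data.Nat.Divisibility using (_∣?_)
  open import Data.Nat.ListAction using (product)
  open import Data.Nat.Primality using (Prime)
  open import Data.List using (List; []; _∷_; foldr; filter)
  open import Data.List.Properties using (filter-all)
  open import Data.List.Relation.Unary.All as All using (All; []; _∷_)
  open import Data.List.Relation.Unary.AllPairs using ([]; _∷_)
  open import Data.List.Relation.Unary.Unique.Propositional using (Unique)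
  open import Data.Unit using (tt)
  open import Relation.Nullary using (yes; no)
  open import Relation.Unary using (Pred; Decidable)
  open import Relation.Unary.Properties using (∁?)
  import Relation.Binary.PropositionalEquality as ≡

  open CommutativeMonoid M
  open import Algebra.Properties.CommutativeSemigroup commutativeSemigroup using (x∙yz≈y∙xz)
  open import Algebra.Solver.CommutativeMonoid M using (solve; _⊜_; _⊕_)
  open import Relation.Binary.Reasoning.Setoid setoid

  prod : (ℕ → Carrier) → List ℕ → Carrier
  prod Φ = foldr (λ e acc → Φ e ∙ acc) ε

  prod-partition : ∀ Φ {p} {P : Pred ℕ p} (P? : Decidable P) xs →
    prod Φ xs ≈ prod Φ (filter P? xs) ∙ prod Φ (filter (∁? P?) xs)
  prod-partition Φ P? []       = sym (identityˡ ε)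
  prod-partition Φ P? (x ∷ xs) with P? x
  ... | yes _ = trans (∙-congˡ (prod-partition Φ P? xs)) (sym (assoc _ _ _))
  ... | no  _ = trans (∙-congˡ (prod-partition Φ P? xs)) (x∙yz≈y∙xz _ _ _)

  module _ (Φ G : ℕ → Carrier) (prod-divisors : ∀ x → 0 < x → prod Φ (divisors x) ≈ G x) where

    möbius : ∀ R z → 0 < z → All Prime R → Unique R →
      prod Φ (fullDivisors R z) ∙ ∏odd G R z ≈ ∏even G R z
    möbius [] z 0<z [] [] = begin
      prod Φ (fullDivisors [] z) ∙ ε ≈⟨ identityʳ _ ⟩
      prod Φ (fullDivisors [] z)     ≡⟨ ≡.cong (prod Φ) (filter-all (isFull? [] z) (All.universal (λ _ → tt) (divisors (z * 1)))) ⟩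
      prod Φ (divisors (z * 1))      ≈⟨ prod-divisors (z * 1) (≡.subst (0 <_) (≡.sym (ℕP.*-identityʳ z)) 0<z) ⟩
      G (z * 1)                      ≡⟨ ≡.cong G (ℕP.*-identityʳ z) ⟩
      G z                            ∎
    möbius (r ∷ R) z 0<z (pr ∷ pR) (r∉R ∷ unique) = begin
      Φfull₊ ∙ (∏odd G R (z * r) ∙ ∏even G R z)           ≈⟨ ∙-congˡ (∙-congˡ (möbius R z 0<z pR unique)) ⟨
      Φfull₊ ∙ (∏odd G R (z * r) ∙ (Φfull ∙ ∏odd G R z))  ≈⟨ rearrange Φfull Φfull₊ (∏odd G R (z * r)) (∏odd G R z) ⟩
      ((Φfull ∙ Φfull₊) ∙ ∏odd G R (z * r)) ∙ ∏odd G R z  ≈⟨ ∙-congʳ (∙-congʳ split) ⟨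
      (Φfullᵣ ∙ ∏odd G R (z * r)) ∙ ∏odd G R z            ≈⟨ ∙-congʳ (möbius R (z * r) (ℕP.*-mono-≤ 0<z (prime>0 pr)) pR unique) ⟩
      ∏even G R (z * r) ∙ ∏odd G R z                       ∎
      where
      Φfull Φfullᵣ Φfull₊ : Carrier
      Φfull  = prod Φ (fullDivisors R z)
      Φfullᵣ = prod Φ (fullDivisors R (z * r))
      Φfull₊ = prod Φ (fullDivisors (r ∷ R) z)
      split : Φfullᵣ ≈ Φfull ∙ Φfull₊
      split = trans (prod-partition Φ (_∣? z * product R) (fullDivisors R (z * r)))
        (∙-cong (reflexive (≡.cong (prod Φ) (fullDivisors-∣ R 0<z pr pR r∉R)))
                (reflexive (≡.cong (prod Φ) (fullDivisors-∤ R z r))))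
      rearrange : ∀ a b c d → b ∙ (c ∙ (a ∙ d)) ≈ ((a ∙ b) ∙ c) ∙ d
      rearrange = solve 4 (λ a b c d → b ⊕ (c ⊕ (a ⊕ d)) ⊜ ((a ⊕ b) ⊕ c) ⊕ d) refl

module Truncation where

  open import Defs
  open Series
  open Primes
  open FullDivisors using (PrimeDivisorsIn; fullDivisors; fullDivisors-self)
  open import Data.Nat as ℕ using (ℕ; zero; suc; _≤_; _<_; _*_; _∸_; _≡ᵇ_; z≤n)
  import Data.Nat.Properties as ℕP
  open import Data.Nat.ListAction using (product)
  open import Data.Nat.Primality using (Prime)
  open import Data.Integer as ℤ using (ℤ; +_; -_; _+_)
  import Data.Integer.Properties as ℤP
  open import Data.Bool using (true; false; if_then_else_; T)
  open import Data.List using (List; []; _∷_; [_])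
  open import Data.List.Relation.Unary.All as All using (All; []; _∷_)
  open import Data.List.Relation.Unary.Unique.Propositional using (Unique)
  open import Data.Product using (_×_; _,_; proj₁; proj₂; swap)
  open import Data.Sum using (_⊎_; inj₁; inj₂)
  open import Data.Empty using (⊥-elim)
  open import Relation.Nullary using (yes; no)
  open import Relation.Binary.Definitions using (tri<; tri≈; tri>)
  open import Relation.Binary.PropositionalEquality using (_≡_; _≢_; refl; sym; trans; cong; cong₂; subst; module ≡-Reasoning)

  ≡ᵇ-refl : ∀ n → (n ≡ᵇ n) ≡ true
  ≡ᵇ-refl zero    = refl
  ≡ᵇ-refl (suc n) = ≡ᵇ-refl n

  ≢⇒≡ᵇ-false : ∀ m n → m ≢ n → (m ≡ᵇ n) ≡ false
  ≢⇒≡ᵇ-false m n m≢n with m ≡ᵇ n in eq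
  ... | false = refl
  ... | true  = ⊥-elim (m≢n (ℕP.≡ᵇ⇒≡ m n (subst T (sym eq) _)))

  onePlusSTd-d : ∀ s d → 0 < d → onePlusSTd s d d ≡ s
  onePlusSTd-d s (suc d) _ rewrite ≡ᵇ-refl d = refl

  onePlusSTd-other : ∀ s d k → k ≢ 0 → k ≢ d → onePlusSTd s d k ≡ + 0
  onePlusSTd-other s d zero    k≢0 _   = ⊥-elim (k≢0 refl)
  onePlusSTd-other s d (suc k) _   k≢d rewrite ≢⇒≡ᵇ-false (suc k) d k≢d = refl

  module _ (s : ℤ) {d : ℕ} (0<d : 0 < d) (f : Series) (k : ℕ) where

    private
      term : ℕ → ℤ
      term j = onePlusSTd s d j ℤ.* f (k ∸ j)

      term-other : ∀ j → suc j ≢ d → term (suc j) ≡ + 0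
      term-other j j+1≢d = trans (cong (ℤ._* f (k ∸ suc j)) (onePlusSTd-other s d (suc j) (λ ()) j+1≢d)) (ℤP.*-zeroˡ (f (k ∸ suc j)))

      sum-below : ∀ i → i < d → sumTo term i ≡ f k
      sum-below zero    _     = ℤP.*-identityˡ (f k)
      sum-below (suc i) i+1<d = trans (cong₂ _+_ (term-other i (ℕP.<⇒≢ i+1<d)) (sum-below i (ℕP.<-trans (ℕP.n<1+n i) i+1<d)))
                                      (ℤP.+-identityˡ (f k))

      sum-above : ∀ i → d ≤ i → sumTo term i ≡ f k + s ℤ.* f (k ∸ d)
      sum-above zero    d≤0 = ⊥-elim (ℕP.<⇒≱ 0<d d≤0)
      sum-above (suc i) d≤i+1 with d ℕP.≟ suc i
      ... | yes refl = trans (cong₂ _+_ (cong (ℤ._* f (k ∸ suc i)) (onePlusSTd-d s (suc i) 0<d)) (sum-below i ℕP.≤-refl))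
                             (ℤP.+-comm _ (f k))
      ... | no d≢i+1 = trans (cong₂ _+_ (term-other i (λ i+1≡d → d≢i+1 (sym i+1≡d))) (sum-above i (ℕP.≤-pred (ℕP.≤∧≢⇒< d≤i+1 d≢i+1))))
                             (ℤP.+-identityˡ _)

    onePlusSTd-⊛-< : k < d → (onePlusSTd s d ⊛ f) k ≡ f k
    onePlusSTd-⊛-< k<d = trans (⊛-as-sumTo (onePlusSTd s d) f k) (sum-below k k<d)

    onePlusSTd-⊛-≥ : d ≤ k → (onePlusSTd s d ⊛ f) k ≡ f k + s ℤ.* f (k ∸ d)
    onePlusSTd-⊛-≥ d≤k = trans (⊛-as-sumTo (onePlusSTd s d) f k) (sum-above k d≤k)

  oneS-≢0 : ∀ {k} → k ≢ 0 → oneS k ≡ + 0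
  oneS-≢0 {zero}  k≢0 = ⊥-elim (k≢0 refl)
  oneS-≢0 {suc _} _   = refl

  onePlusSTd-< : ∀ s {d k} → k < d → onePlusSTd s d k ≡ oneS k
  onePlusSTd-< s {k = zero}  _     = refl
  onePlusSTd-< s {k = suc k} k+1<d = onePlusSTd-other s _ (suc k) (λ ()) (ℕP.<⇒≢ k+1<d)

  1-T^d-inverse : ∀ {d} → 0 < d → (onePlusSTd (- + 1) d ⊛ onePlusSTd (+ 1) d) ≡ oneS modT^ (2 * d)
  1-T^d-inverse {d} 0<d k k<2d with ℕP.<-cmp k d
  ... | tri< k<d _ _ = trans (onePlusSTd-⊛-< (- + 1) 0<d (onePlusSTd (+ 1) d) k k<d) (onePlusSTd-< (+ 1) k<d)
  ... | tri≈ _ refl _ = begin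
    (onePlusSTd (- + 1) d ⊛ onePlusSTd (+ 1) d) d                 ≡⟨ onePlusSTd-⊛-≥ (- + 1) 0<d (onePlusSTd (+ 1) d) d ℕP.≤-refl ⟩
    onePlusSTd (+ 1) d d + - + 1 ℤ.* onePlusSTd (+ 1) d (d ∸ d)   ≡⟨ cong₂ (λ a b → a + - + 1 ℤ.* onePlusSTd (+ 1) d b) (onePlusSTd-d (+ 1) d 0<d) (ℕP.n∸n≡0 d) ⟩
    + 0                                                          ≡⟨ oneS-≢0 (ℕP.>⇒≢ 0<d) ⟨
    oneS d                                                       ∎
    where open ≡-Reasoning
  ... | tri> _ _ d<k = begin
    (onePlusSTd (- + 1) d ⊛ onePlusSTd (+ 1) d) k                 ≡⟨ onePlusSTd-⊛-≥ (- + 1) 0<d (onePlusSTd (+ 1) d) k (ℕP.<⇒≤ d<k) ⟩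
    onePlusSTd (+ 1) d k + - + 1 ℤ.* onePlusSTd (+ 1) d (k ∸ d)   ≡⟨ cong₂ (λ a b → a + - + 1 ℤ.* b) (onePlusSTd-other (+ 1) d k k≢0 (ℕP.>⇒≢ d<k))
                                                                            (onePlusSTd-other (+ 1) d (k ∸ d) k-d≢0 k-d≢d) ⟩
    + 0                                                          ≡⟨ oneS-≢0 k≢0 ⟨
    oneS k                                                       ∎
    where
    open ≡-Reasoning
    k≢0 : k ≢ 0
    k≢0 = ℕP.>⇒≢ (ℕP.≤-<-trans z≤n d<k)
    k-d≢0 : k ∸ d ≢ 0
    k-d≢0 k-d≡0 = ℕP.<⇒≱ d<k (ℕP.m∸n≡0⇒m≤n k-d≡0)
    k-d≢d : k ∸ d ≢ d
    k-d≢d k-d≡d = ℕP.<⇒≢ k<2d (begin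
      k               ≡⟨ ℕP.m∸n+n≡m (ℕP.<⇒≤ d<k) ⟨
      k ∸ d ℕ.+ d     ≡⟨ cong (ℕ._+ d) k-d≡d ⟩
      d ℕ.+ d         ≡⟨ cong (d ℕ.+_) (ℕP.+-identityʳ d) ⟨
      2 * d           ∎)

  TnMinus1-≥ : ∀ {K w} → K ≤ w → TnMinus1 w ≡ constS (- + 1) modT^ K
  TnMinus1-≥         K≤w zero    _     = refl
  TnMinus1-≥ {w = w} K≤w (suc k) k+1<K rewrite ≢⇒≡ᵇ-false (suc k) w (ℕP.<⇒≢ (ℕP.<-≤-trans k+1<K K≤w)) = refl

  -1⊛TnMinus1 : ∀ d k → (constS (- + 1) ⊛ TnMinus1 d) k ≡ onePlusSTd (- + 1) d k
  -1⊛TnMinus1 d k = trans (constS-⊛ (- + 1) (TnMinus1 d) k) (negate (k ≡ᵇ 0) (k ≡ᵇ d))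
    where
    negate : ∀ a b → - + 1 ℤ.* (if a then - + 1 else (if b then + 1 else + 0)) ≡ (if a then + 1 else (if b then - + 1 else + 0))
    negate true  _     = refl
    negate false true  = refl
    negate false false = refl

  -1⊛-1 : ∀ k → (constS (- + 1) ⊛ constS (- + 1)) k ≡ oneS k
  -1⊛-1 k = trans (constS-⊛ (- + 1) (constS (- + 1)) k) (square k)
    where
    square : ∀ k → - + 1 ℤ.* constS (- + 1) k ≡ oneS k
    square zero    = refl
    square (suc _) = refl

  altSign : List ℕ → ℤ
  altSign []      = - + 1
  altSign (_ ∷ R) = - altSign R

  module _ {K : ℕ} where
    open InclusionExclusion (seriesMonoid K) using (parityPair)

    parityPair-altSign : ∀ R g →
      (parityPair R g ≡ (g , oneS) × altSign R ≡ - + 1) ⊎ (parityPair R g ≡ (oneS , g) × altSign R ≡ + 1)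
    parityPair-altSign []      g = inj₁ (refl , refl)
    parityPair-altSign (_ ∷ R) g with parityPair-altSign R g
    ... | inj₁ (pp≡ , s≡) = inj₂ (cong swap pp≡ , cong -_ s≡)
    ... | inj₂ (pp≡ , s≡) = inj₁ (cong swap pp≡ , cong -_ s≡)

  module _ {Φ : ℕ → Series} (cyclotomic : IsCyclotomicFamily Φ) {d : ℕ} (0<d : 0 < d) (r : ℕ) (R : List ℕ)
           (pR : All Prime (r ∷ R)) (unique : Unique (r ∷ R)) (d⊆R : PrimeDivisorsIn d (r ∷ R)) where

    open CommutativeMonoid (seriesMonoid (2 * d))
      using (_≈_; setoid; identityˡ; identityʳ; assoc; ∙-congˡ; ∙-congʳ) renaming (trans to ≈-trans)
    open InclusionExclusion (seriesMonoid (2 * d))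
    open Möbius (seriesMonoid (2 * d))
    open import Relation.Binary.Reasoning.Setoid setoid

    private
      n : ℕ
      n = d * product (r ∷ R)

      1-T^d : Series
      1-T^d = constS (- + 1) ⊛ TnMinus1 d

    Φ-∏odd≈∏even : Φ n ⊛ ∏odd TnMinus1 (r ∷ R) d ≈ ∏even TnMinus1 (r ∷ R) d
    Φ-∏odd≈∏even = begin
      Φ n ⊛ ∏odd TnMinus1 (r ∷ R) d                                ≈⟨ ∙-congʳ (identityʳ (Φ n)) ⟨
      prod Φ [ n ] ⊛ ∏odd TnMinus1 (r ∷ R) d                       ≡⟨ cong (λ xs → prod Φ xs ⊛ ∏odd TnMinus1 (r ∷ R) d) (fullDivisors-self (r ∷ R) 0<d pR d⊆R) ⟨
      prod Φ (fullDivisors (r ∷ R) d) ⊛ ∏odd TnMinus1 (r ∷ R) d    ≈⟨ möbius Φ TnMinus1 (λ x 0<x k _ → cyclotomic x 0<x k) (r ∷ R) d 0<d pR unique ⟩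
      ∏even TnMinus1 (r ∷ R) d                                      ∎

    Φ-parityPair : Φ n ⊛ proj₂ (parityPair (r ∷ R) 1-T^d) ≈ proj₁ (parityPair (r ∷ R) 1-T^d)
    Φ-parityPair = ∏even-∏odd-reduce (λ k _ → -1⊛-1 k) (λ _ 2d≤w → TnMinus1-≥ 2d≤w) r R (All.map prime>1 pR) (Φ n) Φ-∏odd≈∏even

    Φ-mod-T^2d : Φ n ≡ onePlusSTd (altSign (r ∷ R)) d modT^ (2 * d)
    Φ-mod-T^2d with parityPair-altSign (r ∷ R) 1-T^d
    ... | inj₁ (pp≡ , s≡) rewrite s≡ = begin
      Φ n                   ≈⟨ identityʳ (Φ n) ⟨
      Φ n ⊛ oneS            ≈⟨ subst (λ p → Φ n ⊛ proj₂ p ≈ proj₁ p) pp≡ Φ-parityPair ⟩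
      1-T^d                 ≈⟨ (λ k _ → -1⊛TnMinus1 d k) ⟩
      onePlusSTd (- + 1) d  ∎
    ... | inj₂ (pp≡ , s≡) rewrite s≡ = begin
      Φ n                                  ≈⟨ identityʳ (Φ n) ⟨
      Φ n ⊛ oneS                           ≈⟨ ∙-congˡ (≈-trans (∙-congʳ (λ k _ → -1⊛TnMinus1 d k)) (1-T^d-inverse 0<d)) ⟨
      Φ n ⊛ (1-T^d ⊛ onePlusSTd (+ 1) d)   ≈⟨ assoc (Φ n) 1-T^d (onePlusSTd (+ 1) d) ⟨
      (Φ n ⊛ 1-T^d) ⊛ onePlusSTd (+ 1) d   ≈⟨ ∙-congʳ (subst (λ p → Φ n ⊛ proj₂ p ≈ proj₁ p) pp≡ Φ-parityPair) ⟩
      oneS ⊛ onePlusSTd (+ 1) d            ≈⟨ identityˡ (onePlusSTd (+ 1) d) ⟩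
      onePlusSTd (+ 1) d                   ∎

module Congruence where

  open import Data.Nat using (ℕ; zero; suc)
  open import Data.Integer using (ℤ; +_; -_; _+_; _-_; _*_; _^_)
  import Data.Integer.Properties as ℤP
  open import Data.Integer.Divisibility.Signed using (_∣_; divides; ∣m⇒∣-m; ∣m∣n⇒∣m+n; ∣m∣n⇒∣m-n; ∣n⇒∣m*n; ∣m⇒∣m*n)
  open import Data.Integer.Tactic.RingSolver using (solve-∀)
  open import Data.Product using (_,_)
  open import Level using (0ℓ)
  open import Relation.Binary.Bundles using (Setoid)
  open import Relation.Binary.PropositionalEquality using (_≡_; refl; sym; subst)

  infix 4 _≡[_]_

  record _≡[_]_ (x : ℤ) (n : ℕ) (y : ℤ) : Set where
    constructor congruent
    field
      modulus∣difference : + n ∣ x - y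

  open _≡[_]_ public

  module _ {n : ℕ} where

    ≡[]-refl : ∀ x → x ≡[ n ] x
    ≡[]-refl x = congruent (subst (+ n ∣_) (sym (ℤP.+-inverseʳ x)) (divides (+ 0) refl))

    ≡[]-reflexive : ∀ {x y} → x ≡ y → x ≡[ n ] y
    ≡[]-reflexive {x} refl = ≡[]-refl x

    ≡[]-sym : ∀ {x y} → x ≡[ n ] y → y ≡[ n ] x
    ≡[]-sym {x} {y} (congruent n∣x-y) = congruent (subst (+ n ∣_) (negate x y) (∣m⇒∣-m n∣x-y))
      where
      negate : ∀ x y → - (x - y) ≡ y - x
      negate = solve-∀

    ≡[]-trans : ∀ {x y z} → x ≡[ n ] y → y ≡[ n ] z → x ≡[ n ] z
    ≡[]-trans {x} {y} {z} (congruent n∣x-y) (congruent n∣y-z) =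
      congruent (subst (+ n ∣_) (ℤP.+-minus-telescope x y z) (∣m∣n⇒∣m+n n∣x-y n∣y-z))

    ≡[]-+ : ∀ {x y x′ y′} → x ≡[ n ] x′ → y ≡[ n ] y′ → x + y ≡[ n ] x′ + y′
    ≡[]-+ {x} {y} {x′} {y′} (congruent n∣x-x′) (congruent n∣y-y′) =
      congruent (subst (+ n ∣_) (regroup x y x′ y′) (∣m∣n⇒∣m+n n∣x-x′ n∣y-y′))
      where
      regroup : ∀ x y x′ y′ → (x - x′) + (y - y′) ≡ (x + y) - (x′ + y′)
      regroup = solve-∀

    ≡[]-* : ∀ {x y x′ y′} → x ≡[ n ] x′ → y ≡[ n ] y′ → x * y ≡[ n ] x′ * y′
    ≡[]-* {x} {y} {x′} {y′} (congruent n∣x-x′) (congruent n∣y-y′) =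
      congruent (subst (+ n ∣_) (regroup x y x′ y′) (∣m∣n⇒∣m+n (∣n⇒∣m*n x n∣y-y′) (∣m⇒∣m*n y′ n∣x-x′)))
      where
      regroup : ∀ x y x′ y′ → x * (y - y′) + (x - x′) * y′ ≡ x * y - x′ * y′
      regroup = solve-∀

    ≡[]-^ : ∀ {x y} k → x ≡[ n ] y → x ^ k ≡[ n ] y ^ k
    ≡[]-^ zero    _   = ≡[]-refl (+ 1)
    ≡[]-^ (suc k) x≡y = ≡[]-* x≡y (≡[]-^ k x≡y)

  *-mod-commutativeMonoid : ℕ → CommutativeMonoid 0ℓ 0ℓ
  *-mod-commutativeMonoid n = record
    { Carrier = ℤ
    ; _≈_     = _≡[ n ]_
    ; _∙_     = _*_
    ; ε       = + 1
    ; isCommutativeMonoid = record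
      { isMonoid = record
        { isSemigroup = record
          { isMagma = record
            { isEquivalence = record { refl = ≡[]-refl _ ; sym = ≡[]-sym ; trans = ≡[]-trans }
            ; ∙-cong = ≡[]-*
            }
          ; assoc = λ x y z → ≡[]-reflexive (ℤP.*-assoc x y z)
          }
        ; identity = (λ x → ≡[]-reflexive (ℤP.*-identityˡ x)) , (λ x → ≡[]-reflexive (ℤP.*-identityʳ x))
        }
      ; comm = λ x y → ≡[]-reflexive (ℤP.*-comm x y)
      }
    }

  ≡[]-setoid : ℕ → Setoid 0ℓ 0ℓ
  ≡[]-setoid n = CommutativeMonoid.setoid (*-mod-commutativeMonoid n)

  ≡[]-resp-∣ : ∀ {n x y} → x ≡[ n ] y → + n ∣ x → + n ∣ y
  ≡[]-resp-∣ {n} {x} {y} (congruent n∣x-y) n∣x = subst (+ n ∣_) (cancel x y) (∣m∣n⇒∣m-n n∣x n∣x-y)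
    where
    cancel : ∀ x y → x - (x - y) ≡ y
    cancel = solve-∀

module Fermat where

  open Series using (sumTo; sumTo-cong; sumTo-+; sumTo-suc; *-distribˡ-sumTo)
  open Primes
  open Congruence
  open import Data.Nat as ℕ using (ℕ; zero; suc; _≤_; _<_; _∸_; z≤n; s≤s; _!)
  import Data.Nat.Properties as ℕP
  import Data.Nat.Divisibility as ℕ∣
  open import Data.Nat.Primality using (Prime; euclidsLemma)
  open import Data.Nat.Combinatorics using (_C_; nCk+nC[k+1]≡[n+1]C[k+1]; k![n∸k]!∣n!; k>n⇒nCk≡0; nCn≡1; nCk≡n!/k![n-k]!)
  open import Data.Nat.DivMod using (m/n*n≡m)
  open import Data.Integer as ℤ using (ℤ; +_; _+_; _-_; _*_; _^_; ∣_∣)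
  import Data.Integer.Properties as ℤP
  open import Data.Integer.Divisibility.Signed using (_∣_; ∣ᵤ⇒∣; ∣⇒∣ᵤ; ∣m∣n⇒∣m+n; ∣m⇒∣m*n)
  open import Data.Integer.Tactic.RingSolver using (solve-∀)
  open import Data.Sum using (_⊎_; inj₁; inj₂)
  open import Data.Empty using (⊥-elim)
  open import Function using (_∘_)
  open import Relation.Nullary using (¬_)
  open import Relation.Binary.PropositionalEquality

  open ≡-Reasoning

  binomialTerm : ℤ → ℕ → ℕ → ℤ
  binomialTerm x n k = + (n C k) * x ^ k

  binomial-expansion : ∀ x n → (+ 1 + x) ^ n ≡ sumTo (binomialTerm x n) n
  binomial-expansion x zero    = refl
  binomial-expansion x (suc n) = begin
    (+ 1 + x) * (+ 1 + x) ^ n                               ≡⟨ cong ((+ 1 + x) *_) (binomial-expansion x n) ⟩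
    (+ 1 + x) * S                                           ≡⟨ distrib x S ⟩
    x * S + S                                               ≡⟨ cong (_+_ (x * S)) (sym top-vanishes) ⟩
    x * S + sumTo f (suc n)                                 ≡⟨ cong (_+_ (x * S)) (sumTo-suc f n) ⟩
    x * S + (f 0 + sumTo (f ∘ suc) n)                       ≡⟨ left-comm (x * S) (f 0) _ ⟩
    f 0 + (x * S + sumTo (f ∘ suc) n)                       ≡⟨ cong (λ y → f 0 + (y + sumTo (f ∘ suc) n)) (*-distribˡ-sumTo x f n) ⟩
    f 0 + (sumTo (λ k → x * f k) n + sumTo (f ∘ suc) n)     ≡⟨ cong (_+_ (f 0)) (sym (sumTo-+ _ _ n)) ⟩
    f 0 + sumTo (λ k → x * f k + f (suc k)) n               ≡⟨ cong (_+_ (f 0)) (sumTo-cong n (λ k _ → pascal k)) ⟩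
    f 0 + sumTo (f′ ∘ suc) n                                ≡⟨ sumTo-suc f′ n ⟨
    sumTo f′ (suc n)                                        ∎
    where
    f f′ : ℕ → ℤ
    f  = binomialTerm x n
    f′ = binomialTerm x (suc n)
    S : ℤ
    S = sumTo f n
    distrib : ∀ x S → (+ 1 + x) * S ≡ x * S + S
    distrib = solve-∀
    left-comm : ∀ a b c → a + (b + c) ≡ b + (a + c)
    left-comm = solve-∀
    top-vanishes : sumTo f (suc n) ≡ S
    top-vanishes = begin
      + (n C suc n) * x ^ suc n + S ≡⟨ cong (λ c → + c * x ^ suc n + S) (k>n⇒nCk≡0 (ℕP.n<1+n n)) ⟩
      + 0 * x ^ suc n + S           ≡⟨ cong (_+ S) (ℤP.*-zeroˡ (x ^ suc n)) ⟩
      + 0 + S                       ≡⟨ ℤP.+-identityˡ S ⟩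
      S                             ∎
    pascal : ∀ k → x * f k + f (suc k) ≡ f′ (suc k)
    pascal k = begin
      x * (+ (n C k) * x ^ k) + + (n C suc k) * (x * x ^ k) ≡⟨ regroup x (+ (n C k)) (+ (n C suc k)) (x ^ k) ⟩
      (+ (n C k) + + (n C suc k)) * (x * x ^ k)             ≡⟨ cong (λ c → + c * (x * x ^ k)) (nCk+nC[k+1]≡[n+1]C[k+1] n k) ⟩
      + (suc n C suc k) * (x * x ^ k)                       ∎
      where
      regroup : ∀ x a b p → x * (a * p) + b * (x * p) ≡ (a + b) * (x * p)
      regroup = solve-∀

  prime∤! : ∀ {q} → Prime q → ∀ j → j < q → ¬ q ℕ∣.∣ j !
  prime∤! pq zero    _     = prime∤1 pq
  prime∤! pq (suc j) j+1<q = prime∤* pq (ℕ∣.>⇒∤ j+1<q) (prime∤! pq j (ℕP.<-trans (ℕP.n<1+n j) j+1<q))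

  C*k!*[n-k]!≡n! : ∀ {n k} → k ≤ n → (n C k) ℕ.* (k ! ℕ.* (n ∸ k) !) ≡ n !
  C*k!*[n-k]!≡n! {n} {k} k≤n =
    trans (cong (ℕ._* (k ! ℕ.* (n ∸ k) !)) (nCk≡n!/k![n-k]! k≤n)) (m/n*n≡m (k![n∸k]!∣n! k≤n))
    where instance _ = ℕP.m*n≢0 (k !) ((n ∸ k) !) {{k ℕP.!≢0}} {{(n ∸ k) ℕP.!≢0}}

  prime∣C : ∀ {q} → Prime q → ∀ k → 0 < k → k < q → q ℕ∣.∣ q C k
  prime∣C {q} pq k 0<k k<q with euclidsLemma (q C k) (k ! ℕ.* (q ∸ k) !) pq q∣q!
    where
    q∣q! : q ℕ∣.∣ (q C k) ℕ.* (k ! ℕ.* (q ∸ k) !)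
    q∣q! = subst (q ℕ∣.∣_) (sym (C*k!*[n-k]!≡n! (ℕP.<⇒≤ k<q))) (n∣n! (prime>0 pq))
  ... | inj₁ q∣C         = q∣C
  ... | inj₂ q∣k![q-k]!  = ⊥-elim (prime∤* pq (prime∤! pq k k<q) (prime∤! pq (q ∸ k) (ℕP.∸-monoʳ-< 0<k (ℕP.<⇒≤ k<q))) q∣k![q-k]!)

  sumTo-∣ : ∀ {d} F i → (∀ j → j ≤ i → d ∣ F j) → d ∣ sumTo F i
  sumTo-∣ F zero    d∣F = d∣F 0 z≤n
  sumTo-∣ F (suc i) d∣F = ∣m∣n⇒∣m+n (d∣F (suc i) ℕP.≤-refl) (sumTo-∣ F i (λ j j≤i → d∣F j (ℕP.m≤n⇒m≤1+n j≤i)))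

  frobenius : ∀ {q} → Prime q → ∀ x → (+ 1 + x) ^ q ≡[ q ] + 1 + x ^ q
  frobenius {suc (suc p)} pq x = congruent (subst (+ q ∣_) (sym difference) q∣M)
    where
    q : ℕ
    q = suc (suc p)
    f : ℕ → ℤ
    f = binomialTerm x q
    M : ℤ
    M = sumTo (f ∘ suc) p
    q∣M : + q ∣ M
    q∣M = sumTo-∣ (f ∘ suc) p (λ j j≤p → ∣m⇒∣m*n {m = + (q C suc j)} (x ^ suc j) (∣ᵤ⇒∣ (prime∣C pq (suc j) (s≤s z≤n) (s≤s (s≤s j≤p)))))
    f[q]≡x^q : f q ≡ x ^ q
    f[q]≡x^q = trans (cong (λ c → + c * x ^ q) (nCn≡1 q)) (ℤP.*-identityˡ (x ^ q))
    difference : (+ 1 + x) ^ q - (+ 1 + x ^ q) ≡ M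
    difference = begin
      (+ 1 + x) ^ q - (+ 1 + x ^ q)                   ≡⟨ cong (_- (+ 1 + x ^ q)) (binomial-expansion x q) ⟩
      (f q + sumTo f (suc p)) - (+ 1 + x ^ q)         ≡⟨ cong₂ (λ a b → (a + b) - (+ 1 + x ^ q)) f[q]≡x^q (sumTo-suc f p) ⟩
      (x ^ q + (+ 1 + M)) - (+ 1 + x ^ q)             ≡⟨ cancel (x ^ q) M ⟩
      M                                               ∎
      where
      cancel : ∀ a m → (a + (+ 1 + m)) - (+ 1 + a) ≡ m
      cancel = solve-∀

  fermat : ∀ {q} → Prime q → ∀ x → (+ x) ^ q ≡[ q ] + x
  fermat {suc q} pq zero    = ≡[]-reflexive (ℤP.*-zeroˡ ((+ 0) ^ q))
  fermat pq (suc x) = ≡[]-trans (frobenius pq (+ x)) (≡[]-+ (≡[]-refl (+ 1)) (fermat pq x))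

  fermat-little : ∀ {q} → Prime q → ∀ {a} → ¬ q ℕ∣.∣ a → (+ a) ^ (q ∸ 1) ≡[ q ] + 1
  fermat-little {suc p} pq {a} q∤a = cancel (euclidsLemma a ∣ w ∣ pq q∣a*∣w∣)
    where
    w : ℤ
    w = (+ a) ^ p - + 1
    factor : ∀ a P → a * P - a ≡ a * (P - + 1)
    factor = solve-∀
    q∣a*∣w∣ : suc p ℕ∣.∣ a ℕ.* ∣ w ∣
    q∣a*∣w∣ = subst (suc p ℕ∣.∣_) (ℤP.abs-* (+ a) w)
      (∣⇒∣ᵤ (subst (+ suc p ∣_) (factor (+ a) ((+ a) ^ p)) (modulus∣difference (fermat pq a))))
    cancel : suc p ℕ∣.∣ a ⊎ suc p ℕ∣.∣ ∣ w ∣ → (+ a) ^ p ≡[ suc p ] + 1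
    cancel (inj₁ q∣a) = ⊥-elim (q∤a q∣a)
    cancel (inj₂ q∣w) = congruent (∣ᵤ⇒∣ q∣w)

module Valuation where

  open Primes
  open import Data.Nat as ℕ using (ℕ; zero; suc; 2+; _<_; _>_; _+_; _*_; _^_; z≤n; s≤s)
  import Data.Nat.Properties as ℕP
  open import Data.Nat.Divisibility
  open import Data.Nat.Induction using (<-rec)
  open import Data.Nat.Primality using (Prime; prime⇒nonZero)
  open import Data.Nat.Tactic.RingSolver using (solve-∀)
  open import Data.Product using (Σ-syntax; ∃-syntax; _,_)
  open import Data.Sum using (inj₁; inj₂)
  open import Data.Empty using (⊥-elim)
  open import Relation.Nullary using (¬_; yes; no)
  open import Relation.Binary.PropositionalEquality

  module _ {q : ℕ} (pq : Prime q) where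

    private instance _ = prime⇒nonZero pq

    record Decomposition (n : ℕ) : Set where
      constructor decomposition
      field
        exponent   : ℕ
        cofactor   : ℕ
        n≡q^k*r    : n ≡ q ^ exponent * cofactor
        q∤cofactor : ¬ q ∣ cofactor

    decompose : ∀ n → 0 < n → Decomposition n
    decompose = <-rec (λ n → 0 < n → Decomposition n) step
      where
      step : ∀ n → (∀ {m} → m < n → 0 < m → Decomposition m) → 0 < n → Decomposition n
      step n rec 0<n with q ∣? n
      ... | no  q∤n = decomposition 0 n (sym (ℕP.+-identityʳ n)) q∤n
      ... | yes (divides c n≡c*q) =
        let decomposition k r c≡q^k*r q∤r = rec c<n 0<c
        in decomposition (suc k) r (trans n≡c*q (trans (cong (_* q) c≡q^k*r) (rotate q (q ^ k) r))) q∤r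
        where
        0<c : 0 < c
        0<c = ℕP.n≢0⇒n>0 (λ { refl → ℕP.<⇒≢ 0<n (sym n≡c*q) })
        c<n : c < n
        c<n = subst (c <_) (sym n≡c*q) (ℕP.m<m*n c q {{ℕ.>-nonZero 0<c}} (prime>1 pq))
        rotate : ∀ q K r → K * r * q ≡ q * K * r
        rotate = solve-∀

    -- The q-adic valuation; v 0 = 0 is a junk value.
    v : ℕ → ℕ
    v zero    = 0
    v (suc n) = Decomposition.exponent (decompose (suc n) (s≤s z≤n))

    exponent-unique : ∀ k k′ r r′ → q ^ k * r ≡ q ^ k′ * r′ → ¬ q ∣ r → ¬ q ∣ r′ → k ≡ k′
    exponent-unique zero     zero      r r′ _ _   _    = refl
    exponent-unique zero     (suc k′)  r r′ eq q∤r _   =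
      ⊥-elim (q∤r (divides (q ^ k′ * r′) (trans (sym (ℕP.+-identityʳ r)) (trans eq (rotate q (q ^ k′) r′)))))
      where
      rotate : ∀ q K r → q * K * r ≡ K * r * q
      rotate = solve-∀
    exponent-unique (suc k)  zero      r r′ eq q∤r q∤r′ = sym (exponent-unique zero (suc k) r′ r (sym eq) q∤r′ q∤r)
    exponent-unique (suc k)  (suc k′)  r r′ eq q∤r q∤r′ =
      cong suc (exponent-unique k k′ r r′ (ℕP.*-cancelˡ-≡ _ _ q (trans (sym (ℕP.*-assoc q _ r)) (trans eq (ℕP.*-assoc q _ r′)))) q∤r q∤r′)

    v-unique : ∀ {n} k r → n ≡ q ^ k * r → ¬ q ∣ r → v n ≡ k
    v-unique {zero}  k r 0≡q^k*r q∤r with ℕP.m*n≡0⇒m≡0∨n≡0 (q ^ k) (sym 0≡q^k*r)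
    ... | inj₁ q^k≡0 = ⊥-elim (ℕ.≢-nonZero⁻¹ (q ^ k) {{ℕP.m^n≢0 q k}} q^k≡0)
    ... | inj₂ refl  = ⊥-elim (q∤r (q ∣0))
    v-unique {suc n} k r eq q∤r =
      let decomposition k′ r′ eq′ q∤r′ = decompose (suc n) (s≤s z≤n)
      in exponent-unique k′ k r′ r (trans (sym eq′) eq) q∤r′ q∤r

    v≡0 : ∀ {n} → ¬ q ∣ n → v n ≡ 0
    v≡0 {n} q∤n = v-unique 0 n (sym (ℕP.+-identityʳ n)) q∤n

    v>0 : ∀ {n} → 0 < n → q ∣ n → v n > 0
    v>0 {suc n} _ q∣n with decompose (suc n) (s≤s z≤n)
    ... | decomposition zero    r eq q∤r = ⊥-elim (q∤r (subst (q ∣_) (trans eq (ℕP.+-identityʳ r)) q∣n))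
    ... | decomposition (suc _) _ _  _   = s≤s z≤n

    v-* : ∀ {x y} → 0 < x → 0 < y → v (x * y) ≡ v x + v y
    v-* {suc x} {suc y} _ _ with decompose (suc x) (s≤s z≤n) | decompose (suc y) (s≤s z≤n)
    ... | decomposition k r x≡ q∤r | decomposition k′ r′ y≡ q∤r′ =
      v-unique (k + k′) (r * r′) (begin
        suc x * suc y                ≡⟨ cong₂ _*_ x≡ y≡ ⟩
        (q ^ k * r) * (q ^ k′ * r′)  ≡⟨ interchange (q ^ k) (q ^ k′) r r′ ⟩
        (q ^ k * q ^ k′) * (r * r′)  ≡⟨ cong (_* (r * r′)) (ℕP.^-distribˡ-+-* q k k′) ⟨
        q ^ (k + k′) * (r * r′)      ∎)
        (prime∤* pq q∤r q∤r′)
      where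
      open ≡-Reasoning
      interchange : ∀ a b c d → (a * c) * (b * d) ≡ (a * b) * (c * d)
      interchange = solve-∀

  PrimeSeparates : ℕ → ℕ → Set
  PrimeSeparates A B = ∃[ q ] Σ[ pq ∈ Prime q ] v pq A ≢ v pq B

  ∃prime-v≢ : ∀ A {B} → 0 < A → 0 < B → A ≢ B → PrimeSeparates A B
  ∃prime-v≢ = <-rec (λ A → ∀ {B} → 0 < A → 0 < B → A ≢ B → PrimeSeparates A B) step
    where
    step : ∀ A → (∀ {A′} → A′ < A → ∀ {B} → 0 < A′ → 0 < B → A′ ≢ B → PrimeSeparates A′ B) →
      ∀ {B} → 0 < A → 0 < B → A ≢ B → PrimeSeparates A B
    step 1 _ {B} _ 0<B 1≢B with primeFactor B (ℕP.≤∧≢⇒< 0<B 1≢B)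
    ... | q , pq , q∣B = q , pq , λ v1≡vB → ℕP.<⇒≢ (v>0 pq 0<B q∣B) (trans (sym (v≡0 pq (prime∤1 pq))) v1≡vB)
    step A@(2+ _) rec {B} 0<A 0<B A≢B with primeFactor A (s≤s (s≤s z≤n))
    ... | q , pq , q∣A with q ∣? B
    ...   | no q∤B = q , pq , λ vA≡vB → ℕP.<⇒≢ (v>0 pq 0<A q∣A) (sym (trans vA≡vB (v≡0 pq q∤B)))
    ...   | yes q∣B with q∣A | q∣B
    ...     | divides a A≡a*q | divides b B≡b*q =
      let q′ , pq′ , va≢vb = rec a<A 0<a 0<b (λ { refl → A≢B (trans A≡a*q (sym B≡b*q)) })
      in q′ , pq′ , λ vA≡vB → va≢vb (ℕP.+-cancelʳ-≡ _ _ _ (begin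
        v pq′ a + v pq′ q ≡⟨ v-* pq′ 0<a (prime>0 pq) ⟨
        v pq′ (a * q)     ≡⟨ cong (v pq′) A≡a*q ⟨
        v pq′ A           ≡⟨ vA≡vB ⟩
        v pq′ B           ≡⟨ cong (v pq′) B≡b*q ⟩
        v pq′ (b * q)     ≡⟨ v-* pq′ 0<b (prime>0 pq) ⟩
        v pq′ b + v pq′ q ∎))
      where
      open ≡-Reasoning
      0<a : 0 < a
      0<a = ℕP.n≢0⇒n>0 (λ { refl → ℕP.<⇒≢ 0<A (sym A≡a*q) })
      0<b : 0 < b
      0<b = ℕP.n≢0⇒n>0 (λ { refl → ℕP.<⇒≢ 0<B (sym B≡b*q) })
      a<A : a < A
      a<A = subst (a <_) (sym A≡a*q) (ℕP.m<m*n a q {{ℕ.>-nonZero 0<a}} (prime>1 pq))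

module MultiplicativeOrder where

  open Primes
  open Congruence
  open Fermat using (fermat-little)
  open Valuation using (v; v-*; v≡0)
  open import Data.Nat as ℕ using (ℕ; zero; suc; _≤_; _<_; _+_; _*_; _^_; _∸_; z≤n; s≤s; _<?_)
  import Data.Nat.Properties as ℕP
  open import Data.Nat.Divisibility
  open import Data.Nat.DivMod using (_/_; _%_; m≡m%n+[m/n]*n; m%n<n)
  open import Data.Nat.Induction using (<-rec)
  open import Data.Nat.Primality using (Prime; prime⇒nonZero)
  open import Data.Nat.Tactic.RingSolver using (solve-∀)
  open import Data.Integer using (+_) renaming (_+_ to _+ℤ_; _-_ to _-ℤ_; _*_ to _*ℤ_; _^_ to _^ℤ_)
  import Data.Integer.Properties as ℤP
  import Data.Integer.Divisibility.Signed as ℤ∣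
  open import Data.Product using (∃; _×_; _,_; proj₁; proj₂)
  open import Data.Empty using (⊥-elim)
  open import Level using (0ℓ)
  open import Relation.Nullary using (¬_; yes; no; _×-dec_)
  open import Relation.Unary using (Pred; Decidable)
  open import Relation.Binary.PropositionalEquality

  Minimal : Pred ℕ 0ℓ → Pred ℕ 0ℓ
  Minimal P t = P t × (∀ {s} → s < t → ¬ P s)

  least : ∀ {P : Pred ℕ 0ℓ} → Decidable P → ∀ {n} → P n → ∃ (Minimal P)
  least {P} P? {n} = <-rec (λ n → P n → ∃ (Minimal P)) step n
    where
    step : ∀ n → (∀ {m} → m < n → P m → ∃ (Minimal P)) → P n → ∃ (Minimal P)
    step n rec Pn with ℕP.anyUpTo? P? n
    ... | yes (m , m<n , Pm) = rec m<n Pm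
    ... | no  ¬smaller       = n , Pn , λ s<n Ps → ¬smaller (_ , s<n , Ps)

  +-^ : ∀ a n → + (a ^ n) ≡ (+ a) ^ℤ n
  +-^ a zero    = refl
  +-^ a (suc n) = trans (ℤP.pos-* a (a ^ n)) (cong (+ a *ℤ_) (+-^ a n))

  +-∸1 : ∀ {x} → 0 < x → + (x ∸ 1) ≡ + x -ℤ + 1
  +-∸1 {x} 0<x = trans (sym (ℤP.⊖-≥ 0<x)) (sym (ℤP.[+m]-[+n]≡m⊖n x 1))

  ∣∸1⇒≡[]1 : ∀ {q x} → 0 < x → q ∣ x ∸ 1 → + x ≡[ q ] + 1
  ∣∸1⇒≡[]1 0<x q∣x-1 = congruent (subst (ℤ∣._∣_ _) (+-∸1 0<x) (ℤ∣.∣ᵤ⇒∣ q∣x-1))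

  ≡[]1⇒∣∸1 : ∀ {q x} → 0 < x → + x ≡[ q ] + 1 → q ∣ x ∸ 1
  ≡[]1⇒∣∸1 0<x (congruent q∣x-1) = ℤ∣.∣⇒∣ᵤ (subst (ℤ∣._∣_ _) (sym (+-∸1 0<x)) q∣x-1)

  module Order {q a : ℕ} (pq : Prime q) (q∤a : ¬ q ∣ a) where

    private instance
      q≢0 : ℕ.NonZero q
      q≢0 = prime⇒nonZero pq
      a≢0 : ℕ.NonZero a
      a≢0 = ℕ.≢-nonZero (λ { refl → q∤a (q ∣0) })

    a^>0 : ∀ n → 0 < a ^ n
    a^>0 = ℕP.m^n>0 a

    ReturnsAt : ℕ → Set
    ReturnsAt y = 0 < y × q ∣ a ^ y ∸ 1

    returns-at-q-1 : q ∣ a ^ (q ∸ 1) ∸ 1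
    returns-at-q-1 = ≡[]1⇒∣∸1 (a^>0 (q ∸ 1)) (subst (_≡[ q ] + 1) (sym (+-^ a (q ∸ 1))) (fermat-little pq q∤a))

    opaque
      returns-minimally : ∃ (Minimal ReturnsAt)
      returns-minimally = least (λ y → (0 <? y) ×-dec (q ∣? a ^ y ∸ 1)) (ℕP.m<n⇒0<n∸m (prime>1 pq) , returns-at-q-1)

    ord : ℕ
    ord = proj₁ returns-minimally

    0<ord : 0 < ord
    0<ord = proj₁ (proj₁ (proj₂ returns-minimally))

    returns-at-ord : q ∣ a ^ ord ∸ 1
    returns-at-ord = proj₂ (proj₁ (proj₂ returns-minimally))

    ord-minimal : ∀ {s} → s < ord → ¬ ReturnsAt s
    ord-minimal = proj₂ (proj₂ returns-minimally)

    private instance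
      ord≢0 : ℕ.NonZero ord
      ord≢0 = ℕ.>-nonZero 0<ord

    returns⇒≡[]1 : ∀ y → q ∣ a ^ y ∸ 1 → (+ a) ^ℤ y ≡[ q ] + 1
    returns⇒≡[]1 y q∣ = subst (_≡[ q ] + 1) (+-^ a y) (∣∸1⇒≡[]1 (a^>0 y) q∣)

    ∣⇒returns : ∀ {y} → ord ∣ y → q ∣ a ^ y ∸ 1
    ∣⇒returns {y} (divides c refl) = ≡[]1⇒∣∸1 (a^>0 (c * ord)) (subst (_≡[ q ] + 1) (sym (+-^ a (c * ord))) (begin
      (+ a) ^ℤ (c * ord)     ≡⟨ cong ((+ a) ^ℤ_) (ℕP.*-comm c ord) ⟩
      (+ a) ^ℤ (ord * c)     ≡⟨ ℤP.^-*-assoc (+ a) ord c ⟨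
      ((+ a) ^ℤ ord) ^ℤ c    ≈⟨ ≡[]-^ c (returns⇒≡[]1 ord returns-at-ord) ⟩
      (+ 1) ^ℤ c             ≡⟨ ℤP.^-zeroˡ c ⟩
      + 1                    ∎))
      where open import Relation.Binary.Reasoning.Setoid (≡[]-setoid q)

    returns⇒∣ : ∀ {y} → q ∣ a ^ y ∸ 1 → ord ∣ y
    returns⇒∣ {y} q∣ with y % ord ℕP.≟ 0
    ... | yes r≡0 = m%n≡0⇒n∣m y ord r≡0
    ... | no  r≢0 = ⊥-elim (ord-minimal (m%n<n y ord) (ℕP.n≢0⇒n>0 r≢0 , ≡[]1⇒∣∸1 (a^>0 r) (subst (_≡[ q ] + 1) (sym (+-^ a r)) a^r≡1)))
      where
      r k : ℕ
      r = y % ord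
      k = (y / ord) * ord
      a^r≡1 : (+ a) ^ℤ r ≡[ q ] + 1
      a^r≡1 = begin
        (+ a) ^ℤ r                          ≡⟨ ℤP.*-identityʳ ((+ a) ^ℤ r) ⟨
        (+ a) ^ℤ r *ℤ + 1                   ≈⟨ ≡[]-* (≡[]-refl ((+ a) ^ℤ r)) (returns⇒≡[]1 k (∣⇒returns (n∣m*n (y / ord)))) ⟨
        (+ a) ^ℤ r *ℤ (+ a) ^ℤ k            ≡⟨ ℤP.^-distribˡ-+-* (+ a) r k ⟨
        (+ a) ^ℤ (r + k)                    ≡⟨ cong ((+ a) ^ℤ_) (m≡m%n+[m/n]*n y ord) ⟨
        (+ a) ^ℤ y                          ≈⟨ returns⇒≡[]1 y q∣ ⟩
        + 1                                 ∎
        where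
        open import Relation.Binary.Reasoning.Setoid (≡[]-setoid q)

    ord∣q-1 : ord ∣ q ∸ 1
    ord∣q-1 = returns⇒∣ returns-at-q-1

  geometric : ℕ → ℕ → ℕ
  geometric b zero    = 0
  geometric b (suc k) = b ^ k + geometric b k

  geometric-identity : ∀ b k → 0 < b → (b ∸ 1) * geometric b k + 1 ≡ b ^ k
  geometric-identity b       zero    _ = cong (_+ 1) (ℕP.*-zeroʳ (b ∸ 1))
  geometric-identity (suc b) (suc k) _ = begin
    b * (suc b ^ k + geometric (suc b) k) + 1    ≡⟨ distrib b (suc b ^ k) (geometric (suc b) k) ⟩
    b * suc b ^ k + (b * geometric (suc b) k + 1) ≡⟨ cong (_+_ (b * suc b ^ k)) (geometric-identity (suc b) k (s≤s z≤n)) ⟩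
    b * suc b ^ k + suc b ^ k                     ≡⟨ ℕP.+-comm (b * suc b ^ k) (suc b ^ k) ⟩
    suc b ^ (suc k)                               ∎
    where
    open ≡-Reasoning
    distrib : ∀ b x y → b * (x + y) + 1 ≡ b * x + (b * y + 1)
    distrib = solve-∀

  geometric-≡[] : ∀ {q b} k → + b ≡[ q ] + 1 → + geometric b k ≡[ q ] + k
  geometric-≡[] zero    _   = ≡[]-refl (+ 0)
  geometric-≡[] {q} {b} (suc k) b≡1 = subst₂ _≡[ q ]_ (sym (ℤP.pos-+ (b ^ k) (geometric b k))) (ℤP.pos-+ 1 k)
    (≡[]-+ (subst₂ _≡[ q ]_ (sym (+-^ b k)) (ℤP.^-zeroˡ k) (≡[]-^ k b≡1)) (geometric-≡[] k b≡1))

  module _ {q a : ℕ} (pq : Prime q) (q∤a : ¬ q ∣ a) (1<a : 1 < a) where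
    open Order pq q∤a

    -- With b = a ^ ord ≡ 1, a ^ (ord * k) - 1 = (b - 1) (1 + b + ⋯ + b ^ (k - 1)) and the second
    -- factor is ≡ k, a unit modulo q.
    v[a^ord*k∸1] : ∀ {k} → 0 < k → ¬ q ∣ k → v pq (a ^ (ord * k) ∸ 1) ≡ v pq (a ^ ord ∸ 1)
    v[a^ord*k∸1] {suc k′} _ q∤k = begin
      v pq (a ^ (ord * k) ∸ 1)                  ≡⟨ cong (λ x → v pq (x ∸ 1)) (ℕP.^-*-assoc a ord k) ⟨
      v pq (b ^ k ∸ 1)                          ≡⟨ cong (λ x → v pq (x ∸ 1)) (geometric-identity b k (ℕP.<-trans (s≤s z≤n) 1<b)) ⟨
      v pq ((b ∸ 1) * geometric b k + 1 ∸ 1)    ≡⟨ cong (v pq) (ℕP.m+n∸n≡m ((b ∸ 1) * geometric b k) 1) ⟩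
      v pq ((b ∸ 1) * geometric b k)            ≡⟨ v-* pq (ℕP.m<n⇒0<n∸m 1<b) 0<geometric ⟩
      v pq (b ∸ 1) + v pq (geometric b k)       ≡⟨ cong (_+_ (v pq (b ∸ 1))) (v≡0 pq q∤geometric) ⟩
      v pq (b ∸ 1) + 0                          ≡⟨ ℕP.+-identityʳ _ ⟩
      v pq (b ∸ 1)                              ∎
      where
      open ≡-Reasoning
      k b : ℕ
      k = suc k′
      b = a ^ ord
      1<b : 1 < b
      1<b = ℕP.^-monoʳ-< a 1<a 0<ord
      0<geometric : 0 < geometric b k
      0<geometric = ℕP.≤-trans (a^>0 (ord * k′)) (subst (_≤ geometric b k) (ℕP.^-*-assoc a ord k′) (ℕP.m≤m+n (b ^ k′) _))
      q∤geometric : ¬ q ∣ geometric b k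
      q∤geometric q∣G = q∤k (ℤ∣.∣⇒∣ᵤ (≡[]-resp-∣ (geometric-≡[] k (subst (_≡[ q ] + 1) (sym (+-^ a ord)) (returns⇒≡[]1 ord returns-at-ord))) (ℤ∣.∣ᵤ⇒∣ q∣G)))

module Dirichlet where

  open Primes
  open Congruence
  open Valuation
  open MultiplicativeOrder
  open FullDivisors using (PrimeDivisorsIn; PrimeDivisorsIn-*)
  open import Data.Nat as ℕ using (ℕ; suc; _≤_; _<_; _+_; _*_; _^_; _∸_; z≤n; s≤s; _!)
  import Data.Nat.Properties as ℕP
  open import Data.Nat.Divisibility
  open import Data.Nat.ListAction using (product)
  open import Data.Nat.Primality using (Prime; prime⇒nonZero)
  open import Data.Integer using (+_; -_) renaming (_+_ to _+ℤ_; _-_ to _-ℤ_; _*_ to _*ℤ_)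
  import Data.Integer.Properties as ℤP
  import Data.Integer.Divisibility.Signed as ℤ∣
  open import Data.Integer.Tactic.RingSolver using (solve-∀)
  open import Data.Nat.Tactic.RingSolver using () renaming (solve-∀ to ℕsolve-∀)
  open import Data.Nat.Primality.Factorisation using (factorisationHasAllPrimeFactors)
  open import Data.List.Relation.Unary.AllPairs using (_∷_)
  open import Data.List.Relation.Unary.Unique.Propositional using (Unique)
  open import Data.List.Relation.Unary.Any using (here; there)
  open import Data.List.Membership.Propositional using (_∈_)
  open import Data.List using (List; []; _∷_)
  open import Data.List.Relation.Unary.All as All using (All; []; _∷_)
  open import Data.Product using (Σ-syntax; ∃-syntax; _×_; _,_; proj₁; proj₂)
  open import Data.Empty using (⊥-elim)
  open import Function using (_∘_)
  open import Relation.Nullary using (¬_; yes; no)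
  open import Relation.Binary.PropositionalEquality

  module ℕ* = InclusionExclusion ℕP.*-1-commutativeMonoid
  module ℕ+ = InclusionExclusion ℕP.+-0-commutativeMonoid

  ∏even-∏odd-positive : ∀ {G} → (∀ {y} → 0 < y → 0 < G y) → ∀ R {z} → 0 < z → All (0 <_) R →
    0 < ℕ*.∏even G R z × 0 < ℕ*.∏odd G R z
  ∏even-∏odd-positive G>0 []      0<z []           = G>0 0<z , s≤s z≤n
  ∏even-∏odd-positive G>0 (r ∷ R) 0<z (0<r ∷ 0<R) =
    let (even₁ , odd₁) = ∏even-∏odd-positive G>0 R (ℕP.*-mono-≤ 0<z 0<r) 0<R
        (even₀ , odd₀) = ∏even-∏odd-positive G>0 R 0<z 0<R
    in ℕP.*-mono-≤ even₁ odd₀ , ℕP.*-mono-≤ odd₁ even₀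

  v-∏even-∏odd : ∀ {q} (pq : Prime q) {G} → (∀ {y} → 0 < y → 0 < G y) → ∀ R {z} → 0 < z → All (0 <_) R →
    v pq (ℕ*.∏even G R z) ≡ ℕ+.∏even (v pq ∘ G) R z × v pq (ℕ*.∏odd G R z) ≡ ℕ+.∏odd (v pq ∘ G) R z
  v-∏even-∏odd pq G>0 []      0<z []           = refl , v≡0 pq (prime∤1 pq)
  v-∏even-∏odd pq {G} G>0 (r ∷ R) {z} 0<z (0<r ∷ 0<R) =
    let (even₁ , odd₁) = v-∏even-∏odd pq G>0 R 0<zr 0<R
        (even₀ , odd₀) = v-∏even-∏odd pq G>0 R 0<z 0<R
        (pos-even₁ , pos-odd₁) = ∏even-∏odd-positive G>0 R 0<zr 0<R
        (pos-even₀ , pos-odd₀) = ∏even-∏odd-positive G>0 R 0<z 0<R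
    in trans (v-* pq pos-even₁ pos-odd₀) (cong₂ _+_ even₁ odd₀) ,
       trans (v-* pq pos-odd₁ pos-even₀) (cong₂ _+_ odd₁ even₀)
    where
    0<zr : 0 < z * r
    0<zr = ℕP.*-mono-≤ 0<z 0<r

  module _ (N : ℕ) where
    private module ℤN = InclusionExclusion (*-mod-commutativeMonoid N)

    +-∏even-∏odd : ∀ G R z → + ℕ*.∏even G R z ≡ ℤN.∏even (+_ ∘ G) R z × + ℕ*.∏odd G R z ≡ ℤN.∏odd (+_ ∘ G) R z
    +-∏even-∏odd G []      z = refl , refl
    +-∏even-∏odd G (r ∷ R) z =
      let (even₁ , odd₁) = +-∏even-∏odd G R (z * r)
          (even₀ , odd₀) = +-∏even-∏odd G R z
      in trans (ℤP.pos-* (ℕ*.∏even G R (z * r)) (ℕ*.∏odd G R z)) (cong₂ _*ℤ_ even₁ odd₀) ,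
         trans (ℤP.pos-* (ℕ*.∏odd G R (z * r)) (ℕ*.∏even G R z)) (cong₂ _*ℤ_ odd₁ even₀)

  module _ {a : ℕ} (1<a : 1 < a) where

    private instance
      a≢0 : ℕ.NonZero a
      a≢0 = ℕ.>-nonZero (ℕP.<-trans (s≤s z≤n) 1<a)

    a^∸1 : ℕ → ℕ
    a^∸1 y = a ^ y ∸ 1

    a^∸1>0 : ∀ {y} → 0 < y → 0 < a^∸1 y
    a^∸1>0 0<y = ℕP.m<n⇒0<n∸m (ℕP.^-monoʳ-< a 1<a 0<y)

    a^∸1≡-1 : ∀ {K w} → K ≤ w → + a^∸1 w ≡[ a ^ K ] - + 1
    a^∸1≡-1 {K} {w} K≤w = congruent (subst (ℤ∣._∣_ (+ (a ^ K))) +a^w≡ (ℤ∣.∣ᵤ⇒∣ a^K∣a^w))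
      where
      add-back : ∀ x → x ≡ (x -ℤ + 1) -ℤ - + 1
      add-back = solve-∀
      +a^w≡ : + (a ^ w) ≡ + a^∸1 w -ℤ - + 1
      +a^w≡ = trans (add-back (+ (a ^ w))) (cong (λ x → x -ℤ - + 1) (sym (+-∸1 (ℕP.m^n>0 a w))))
      a^K∣a^w : a ^ K ∣ a ^ w
      a^K∣a^w = divides (a ^ (w ∸ K)) (trans (cong (a ^_) (sym (ℕP.m∸n+n≡m K≤w))) (ℕP.^-distribˡ-+-* a (w ∸ K) K))

    1-a^d≡1⇒ : ∀ {N d} → - + 1 *ℤ + a^∸1 d ≡[ N ] + 1 → N ∣ a ^ d
    1-a^d≡1⇒ {N} {d} (congruent N∣) = ℤ∣.∣⇒∣ᵤ (subst (ℤ∣._∣_ (+ N)) negated (ℤ∣.∣m⇒∣-m N∣))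
      where
      negate : ∀ x → - ((- + 1 *ℤ (x -ℤ + 1)) -ℤ + 1) ≡ x
      negate = solve-∀
      negated : - (- + 1 *ℤ + a^∸1 d -ℤ + 1) ≡ + (a ^ d)
      negated = trans (cong (λ x → - ((- + 1 *ℤ x) -ℤ + 1)) (+-∸1 (ℕP.m^n>0 a d))) (negate (+ (a ^ d)))

    -- Modulo a ^ (2 d) every factor except a ^ d - 1 is -1, so ∏even ≡ ∏odd would force a ^ (2 d) ∣ a ^ d.
    ∏even≢∏odd : ∀ {d} → 0 < d → ∀ r R → All Prime (r ∷ R) → ℕ*.∏even a^∸1 (r ∷ R) d ≢ ℕ*.∏odd a^∸1 (r ∷ R) d
    ∏even≢∏odd {d} 0<d r R pR even≡odd =
      >⇒∤ {{ℕP.m^n≢0 a d}} (ℕP.^-monoʳ-< a 1<a d<2d) (1-a^d≡1⇒ {d = d} (ℤN.parityPair-trivial (r ∷ R) _ reduced))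
      where
      module ℤN = InclusionExclusion (*-mod-commutativeMonoid (a ^ (2 * d)))
      d<2d : d < 2 * d
      d<2d = subst (d <_) (cong (_+_ d) (sym (ℕP.+-identityʳ d))) (ℕP.m<m+n d 0<d)
      odd≈even : + 1 *ℤ ℤN.∏odd (+_ ∘ a^∸1) (r ∷ R) d ≡[ a ^ (2 * d) ] ℤN.∏even (+_ ∘ a^∸1) (r ∷ R) d
      odd≈even = ≡[]-reflexive (begin
        + 1 *ℤ ℤN.∏odd (+_ ∘ a^∸1) (r ∷ R) d ≡⟨ ℤP.*-identityˡ _ ⟩
        ℤN.∏odd (+_ ∘ a^∸1) (r ∷ R) d        ≡⟨ proj₂ (+-∏even-∏odd (a ^ (2 * d)) a^∸1 (r ∷ R) d) ⟨
        + ℕ*.∏odd a^∸1 (r ∷ R) d              ≡⟨ cong +_ even≡odd ⟨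
        + ℕ*.∏even a^∸1 (r ∷ R) d             ≡⟨ proj₁ (+-∏even-∏odd (a ^ (2 * d)) a^∸1 (r ∷ R) d) ⟩
        ℤN.∏even (+_ ∘ a^∸1) (r ∷ R) d       ∎)
        where open ≡-Reasoning
      reduced : + 1 *ℤ proj₂ (ℤN.parityPair (r ∷ R) (- + 1 *ℤ + a^∸1 d))
                  ≡[ a ^ (2 * d) ] proj₁ (ℤN.parityPair (r ∷ R) (- + 1 *ℤ + a^∸1 d))
      reduced = ℤN.∏even-∏odd-reduce (≡[]-refl (+ 1)) (λ _ → a^∸1≡-1) r R (All.map prime>1 pR) (+ 1) odd≈even

  product-remove : ∀ {p} R → p ∈ R → All Prime R → Unique R → ∃[ P ] product R ≡ p * P × ¬ p ∣ P
  product-remove (r ∷ R) (here refl) (pr ∷ pR) (r∉R ∷ _) =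
    product R , refl , λ r∣∏R → All.lookup r∉R (factorisationHasAllPrimeFactors pr r∣∏R pR) refl
  product-remove {p} (r ∷ R) (there p∈R) (pr ∷ pR) (r∉R ∷ unique) =
    let P , ∏R≡pP , p∤P = product-remove R p∈R pR unique
    in r * P , trans (cong (r *_) ∏R≡pP) (left-comm r p P) , prime∤* pp (prime∤prime pp pr p≢r) p∤P
    where
    pp : Prime p
    pp = All.lookup pR p∈R
    p≢r : p ≢ r
    p≢r refl = All.lookup r∉R p∈R refl
    left-comm : ∀ r p P → r * (p * P) ≡ p * (r * P)
    left-comm = ℕsolve-∀

  onMultiples : ℕ → ℕ → ℕ → ℕ
  onMultiples t w y with t ∣? y
  ... | yes _ = w
  ... | no  _ = 0

  onMultiples-cong : ∀ {t w x y} → (t ∣ x → t ∣ y) → (t ∣ y → t ∣ x) → onMultiples t w x ≡ onMultiples t w y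
  onMultiples-cong {t} {w} {x} {y} x⇒y y⇒x with t ∣? x | t ∣? y
  ... | yes _     | yes _     = refl
  ... | no  _     | no  _     = refl
  ... | yes t∣x   | no  t∤y   = ⊥-elim (t∤y (x⇒y t∣x))
  ... | no  t∤x   | yes t∣y   = ⊥-elim (t∤x (y⇒x t∣y))

  prime∣⇒∤^∸1 : ∀ {q a} → Prime q → 0 < a → q ∣ a → ∀ {y} → 0 < y → ¬ q ∣ a ^ y ∸ 1
  prime∣⇒∤^∸1 {q} {a} pq 0<a q∣a {suc y} _ q∣a^y∸1 = prime∤1 pq (∣m+n∣m⇒∣n q∣a^y∸1+1 q∣a^y∸1)
    where
    q∣a^y∸1+1 : q ∣ a ^ suc y ∸ 1 + 1
    q∣a^y∸1+1 = subst (q ∣_) (sym (ℕP.m∸n+n≡m (ℕP.m^n>0 a {{ℕ.>-nonZero 0<a}} (suc y)))) (∣m⇒∣m*n (a ^ y) q∣a)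

  module _ {d r : ℕ} {R : List ℕ} (0<d : 0 < d) (pR : All Prime (r ∷ R)) (unique : Unique (r ∷ R))
           (d⊆R : PrimeDivisorsIn d (r ∷ R)) where

    m : ℕ
    m = d * product (r ∷ R)

    0<m : 0 < m
    0<m = *-productOfPrimes>0 0<d pR

    divisor>0 : ∀ {y} → y ∣ m → 0 < y
    divisor>0 y∣m = ℕP.n≢0⇒n>0 (λ { refl → ℕP.<⇒≢ 0<m (sym (0∣⇒≡0 y∣m)) })

    -- p is any prime factor of m / t; then t ∣ d * (∏ R / p) and p ∤ ∏ R / p.
    ∃ignored-prime : ∀ {t} → t ∣ m → t ≢ m → ∃[ p ] p ∈ r ∷ R × (∀ {x} → ¬ p ∣ x → t ∣ d * p * x → t ∣ d * x)
    ∃ignored-prime {t} t∣m t≢m = p , p∈R , λ _ → ∣-drop-prime {d = d} pp p∤P t∣dP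
      where
      factor : ∃[ p ] Prime p × p ∣ quotient t∣m
      factor = primeFactor (quotient t∣m) (quotient>1 t∣m (ℕP.≤∧≢⇒< (∣⇒≤ {{ℕ.>-nonZero 0<m}} t∣m) t≢m))
      p : ℕ
      p = proj₁ factor
      pp : Prime p
      pp = proj₁ (proj₂ factor)
      p*t∣m : p * t ∣ m
      p*t∣m = subst (p * t ∣_) (sym (m∣n⇒n≡quotient*m t∣m)) (*-monoˡ-∣ t (proj₂ (proj₂ factor)))
      p∈R : p ∈ r ∷ R
      p∈R = PrimeDivisorsIn-* pR d⊆R pp (∣-trans (∣m⇒∣m*n t ∣-refl) p*t∣m)
      removed : ∃[ P ] product (r ∷ R) ≡ p * P × ¬ p ∣ P
      removed = product-remove (r ∷ R) p∈R pR unique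
      P : ℕ
      P = proj₁ removed
      p∤P : ¬ p ∣ P
      p∤P = proj₂ (proj₂ removed)
      t∣dP : t ∣ d * P
      t∣dP = *-cancelʳ-∣ p {{prime⇒nonZero pp}} (subst₂ _∣_ (ℕP.*-comm p t) m≡dPp p*t∣m)
        where
        rotate : ∀ d p P → d * (p * P) ≡ d * P * p
        rotate = ℕsolve-∀
        m≡dPp : m ≡ d * P * p
        m≡dPp = trans (cong (d *_) (proj₁ (proj₂ removed))) (rotate d p P)

    Separating : (ℕ → ℕ) → Set
    Separating f = ℕ+.∏even f (r ∷ R) d ≢ ℕ+.∏odd f (r ∷ R) d

    Separating-cong : ∀ {f g} → (∀ y → y ∣ m → f y ≡ g y) → Separating f → Separating g
    Separating-cong f≗g sep even≡odd =
      let (even , odd) = ℕ+.∏even-∏odd-cong (r ∷ R) d f≗g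
      in sep (trans even (trans even≡odd (sym odd)))

    ¬Separating-0 : ¬ Separating (λ _ → 0)
    ¬Separating-0 sep = let (even , odd) = ℕ+.∏even-∏odd-ε (r ∷ R) d in sep (trans even (sym odd))

    ¬Separating-ignoring : ∀ {p f} → p ∈ r ∷ R → ℕ+.IgnoresFactor p f d → ¬ Separating f
    ¬Separating-ignoring p∈R ignores sep = sep (ℕ+.∏even≈∏odd-ignored (r ∷ R) d p∈R pR unique ignores)

    ∃separating-prime : ∀ {a} (1<a : 1 < a) → ∃[ q ] Σ[ pq ∈ Prime q ] Separating (v pq ∘ a^∸1 1<a)
    ∃separating-prime 1<a =
      let (even>0 , odd>0) = ∏even-∏odd-positive (a^∸1>0 1<a) (r ∷ R) 0<d (All.map prime>0 pR)
          q , pq , v-even≢v-odd = ∃prime-v≢ _ even>0 odd>0 (∏even≢∏odd 1<a 0<d r R pR)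
          (v-even , v-odd) = v-∏even-∏odd pq (a^∸1>0 1<a) (r ∷ R) 0<d (All.map prime>0 pR)
      in q , pq , λ even≡odd → v-even≢v-odd (trans v-even (trans even≡odd (sym v-odd)))

    module _ {q a : ℕ} (pq : Prime q) (1<a : 1 < a) (separating : Separating (v pq ∘ a^∸1 1<a)) where

      q∤a : ¬ q ∣ a
      q∤a q∣a = ¬Separating-0 (Separating-cong vanishes separating)
        where
        vanishes : ∀ y → y ∣ m → v pq (a^∸1 1<a y) ≡ 0
        vanishes y y∣m = v≡0 pq (prime∣⇒∤^∸1 pq (ℕP.<-trans (s≤s z≤n) 1<a) q∣a (divisor>0 y∣m))

      open Order pq q∤a

      module _ (q∤m : ¬ q ∣ m) where

        v∘a^∸1≗onMultiples : ∀ y → y ∣ m → v pq (a^∸1 1<a y) ≡ onMultiples ord (v pq (a^∸1 1<a ord)) y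
        v∘a^∸1≗onMultiples y y∣m with ord ∣? y
        ... | no ord∤y = v≡0 pq (λ q∣ → ord∤y (returns⇒∣ q∣))
        ... | yes (divides k y≡k*ord) =
          trans (cong (v pq ∘ a^∸1 1<a) y≡ord*k) (v[a^ord*k∸1] pq q∤a 1<a 0<k q∤k)
          where
          y≡ord*k : y ≡ ord * k
          y≡ord*k = trans y≡k*ord (ℕP.*-comm k ord)
          0<k : 0 < k
          0<k = ℕP.n≢0⇒n>0 (λ { refl → ℕP.<⇒≢ (divisor>0 y∣m) (sym (trans y≡ord*k (ℕP.*-zeroʳ ord))) })
          q∤k : ¬ q ∣ k
          q∤k q∣k = q∤m (∣-trans q∣k (∣-trans (divides ord y≡ord*k) y∣m))

        ord∣m : ord ∣ m
        ord∣m with ord ∣? m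
        ... | yes ord∣m = ord∣m
        ... | no  ord∤m = ⊥-elim (¬Separating-0 (Separating-cong vanishes separating))
          where
          vanishes : ∀ y → y ∣ m → v pq (a^∸1 1<a y) ≡ 0
          vanishes y y∣m = v≡0 pq (λ q∣ → ord∤m (∣-trans (returns⇒∣ q∣) y∣m))

        ord≡m : ord ≡ m
        ord≡m with ord ℕP.≟ m
        ... | yes ord≡m = ord≡m
        ... | no  ord≢m =
          let p , p∈R , cancel = ∃ignored-prime ord∣m ord≢m
              ignores : ℕ+.IgnoresFactor p (onMultiples ord (v pq (a^∸1 1<a ord))) d
              ignores x p∤x = onMultiples-cong (cancel p∤x) (λ ord∣dx → subst (ord ∣_) (rotate d x p) (∣m⇒∣m*n p ord∣dx))
          in ⊥-elim (¬Separating-ignoring p∈R ignores (Separating-cong v∘a^∸1≗onMultiples separating))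
          where
          rotate : ∀ d x p → d * x * p ≡ d * p * x
          rotate = ℕsolve-∀

    ∃prime≡1-mod : ∀ N → ∃[ p ] Prime p × N < p × m ∣ p ∸ 1
    ∃prime≡1-mod N =
      let q , pq , separating = ∃separating-prime 1<a
          q∤a = q∤a pq 1<a separating
          q∤m : ¬ q ∣ m
          q∤m q∣m = q∤a (∣-trans q∣m (∣n⇒∣m*n 2 (∣m⇒∣m*n (N !) ∣-refl)))
          N<q : N < q
          N<q = ℕP.≰⇒> (λ q≤N → q∤a (∣-trans (∣-trans (n∣n! (prime>0 pq)) (m≤n⇒m!∣n! q≤N)) (∣n⇒∣m*n 2 (n∣m*n m))))
      in q , pq , N<q , subst (_∣ q ∸ 1) (ord≡m pq 1<a separating q∤m) (Order.ord∣q-1 pq q∤a)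
      where
      1<a : 1 < 2 * (m * N !)
      1<a = ℕP.*-monoʳ-≤ 2 (ℕP.*-mono-≤ 0<m (ℕ.>-nonZero⁻¹ (N !) {{N ℕP.!≢0}}))

open import Defs
open Primes
open FullDivisors using (PrimeDivisorsIn)
open Truncation using (altSign; Φ-mod-T^2d)
open Dirichlet using (∃prime≡1-mod)
open import Data.Nat as ℕ using (ℕ; suc; _≤_; _<_; _*_; _∸_; z≤n; s≤s)
import Data.Nat.Properties as ℕP
open import Data.Nat.Divisibility using (_∣_; ∣⇒≤; ∣-trans; ∣n⇒∣m*n; ∣-refl)
open import Data.Nat.ListAction using (product)
open import Data.Nat.ListAction.Properties using (∈⇒∣product)
open import Data.Nat.Primality using (Prime; prime?; prime[2])
open import Data.Nat.Tactic.RingSolver using (solve-∀)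
open import Data.Integer as ℤ using (ℤ; +_; -_)
import Data.Integer.Properties as ℤP
open import Data.List using (List; []; _∷_; filter; upTo)
open import Data.List.Relation.Unary.All as All using (All; []; _∷_)
open import Data.List.Relation.Unary.All.Properties using (all-filter)
open import Data.List.Relation.Unary.AllPairs using ([]; _∷_)
open import Data.List.Relation.Unary.Unique.Propositional using (Unique)
open import Data.List.Relation.Unary.Unique.Propositional.Properties using (upTo⁺; filter⁺)
open import Data.List.Relation.Unary.Any using (there)
open import Data.List.Membership.Propositional.Properties using (∈-filter⁺; ∈-filter⁻; ∈-upTo⁺; ∈-upTo⁻)
open import Data.Product using (∃-syntax; _×_; _,_; proj₁; map₂)
open import Data.Sum using (_⊎_; inj₁; inj₂)
open import Data.Empty using (⊥-elim)
open import Relation.Binary.PropositionalEquality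

record Admissible (d : ℕ) (R : List ℕ) : Set where
  field
    primes   : All Prime R
    unique   : Unique R
    complete : PrimeDivisorsIn d R

Admissible-∷ : ∀ {d R p} → Admissible d R → Prime p → All (_< p) R → Admissible d (p ∷ R)
Admissible-∷ adm pp R<p = record
  { primes   = pp ∷ primes
  ; unique   = All.map (λ r<p p≡r → ℕP.<⇒≢ r<p (sym p≡r)) R<p ∷ unique
  ; complete = λ pq q∣d → there (complete pq q∣d)
  }
  where open Admissible adm

primesUpTo : ℕ → List ℕ
primesUpTo d = filter prime? (upTo (suc d))

primesUpTo-admissible : ∀ {d} → 0 < d → Admissible d (primesUpTo d)
primesUpTo-admissible {d} 0<d = record
  { primes   = all-filter prime? (upTo (suc d))
  ; unique   = filter⁺ prime? (upTo⁺ (suc d))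
  ; complete = λ pq q∣d → ∈-filter⁺ prime? (∈-upTo⁺ (s≤s (∣⇒≤ {{ℕ.>-nonZero 0<d}} q∣d))) pq
  }

primesUpTo-bounded : ∀ d → All (_≤ d) (primesUpTo d)
primesUpTo-bounded d = All.tabulate (λ q∈ → ℕP.≤-pred (∈-upTo⁻ (proj₁ (∈-filter⁻ prime? q∈))))

∃prime> : ∀ N → ∃[ p ] Prime p × N < p
∃prime> N =
  let p , pp , N<p , _ = ∃prime≡1-mod {d = 1} {r = 2} {R = []} (s≤s z≤n) (prime[2] ∷ []) ([] ∷ [])
                           (λ pq q∣1 → ⊥-elim (prime∤1 pq q∣1)) N
  in p , pp , N<p

altSign-±1 : ∀ R → altSign R ≡ + 1 ⊎ altSign R ≡ - + 1
altSign-±1 []      = inj₂ refl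
altSign-±1 (_ ∷ R) with altSign-±1 R
... | inj₁ s≡1  = inj₂ (cong -_ s≡1)
... | inj₂ s≡-1 = inj₁ (cong -_ s≡-1)

±1-keep-or-negate : ∀ {x t : ℤ} → x ≡ + 1 ⊎ x ≡ - + 1 → t ≡ + 1 ⊎ t ≡ - + 1 → x ≡ t ⊎ - x ≡ t
±1-keep-or-negate (inj₁ refl) (inj₁ refl) = inj₁ refl
±1-keep-or-negate (inj₁ refl) (inj₂ refl) = inj₂ refl
±1-keep-or-negate (inj₂ refl) (inj₁ refl) = inj₂ refl
±1-keep-or-negate (inj₂ refl) (inj₂ refl) = inj₁ refl

∃admissible-with-sign : ∀ {d} → 0 < d → ∀ {t} → t ≡ + 1 ⊎ t ≡ - + 1 →
  ∃[ r ] ∃[ R ] Admissible d (r ∷ R) × altSign (r ∷ R) ≡ t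
∃admissible-with-sign {d} 0<d {t} t≡±1 = extend (∃prime> d)
  where
  Goal : Set
  Goal = ∃[ r ] ∃[ R ] Admissible d (r ∷ R) × altSign (r ∷ R) ≡ t
  extend : ∃[ q ] Prime q × d < q → Goal
  extend (q₁ , pq₁ , d<q₁) = adjust (±1-keep-or-negate (altSign-±1 (q₁ ∷ primesUpTo d)) t≡±1) (∃prime> q₁)
    where
    P<q₁ : All (_< q₁) (primesUpTo d)
    P<q₁ = All.map (λ q≤d → ℕP.≤-<-trans q≤d d<q₁) (primesUpTo-bounded d)
    adm₁ : Admissible d (q₁ ∷ primesUpTo d)
    adm₁ = Admissible-∷ (primesUpTo-admissible 0<d) pq₁ P<q₁
    adjust : altSign (q₁ ∷ primesUpTo d) ≡ t ⊎ - altSign (q₁ ∷ primesUpTo d) ≡ t → ∃[ q ] Prime q × q₁ < q → Goal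
    adjust (inj₁ sign≡t)  _                  = q₁ , primesUpTo d , adm₁ , sign≡t
    adjust (inj₂ -sign≡t) (q₂ , pq₂ , q₁<q₂) =
      q₂ , q₁ ∷ primesUpTo d , Admissible-∷ adm₁ pq₂ (q₁<q₂ ∷ All.map (λ q<q₁ → ℕP.<-trans q<q₁ q₁<q₂) P<q₁) , -sign≡t

∣∸1⇒< : ∀ {r p} → r ∣ p ∸ 1 → 1 < p → r < p
∣∸1⇒< r∣p-1 1<p = ℕP.≤-<-trans (∣⇒≤ {{ℕ.>-nonZero (ℕP.m<n⇒0<n∸m 1<p)}} r∣p-1) (ℕP.∸-monoʳ-< (s≤s z≤n) (ℕP.<⇒≤ 1<p))

∃special> : ∀ {Φ} → IsCyclotomicFamily Φ → ∀ {d} → 0 < d → ∀ r R → Admissible d (r ∷ R) → ∀ N →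
  ∃[ n ] N < n × SpecialForm n × Φ n ≡ onePlusSTd (- altSign (r ∷ R)) d modT^ (2 * d)
∃special> {Φ} cyclotomic {d} 0<d r R adm N = special (∃prime≡1-mod 0<d primes unique complete N)
  where
  open Admissible adm
  m : ℕ
  m = d * product (r ∷ R)
  left-comm : ∀ d p P → d * (p * P) ≡ p * (d * P)
  left-comm = solve-∀
  special : ∃[ p ] Prime p × N < p × m ∣ p ∸ 1 →
    ∃[ n ] N < n × SpecialForm n × Φ n ≡ onePlusSTd (- altSign (r ∷ R)) d modT^ (2 * d)
  special (p , pp , N<p , m∣p-1) =
    p * m , ℕP.<-≤-trans N<p (ℕP.m≤m*n p m {{ℕ.>-nonZero (*-productOfPrimes>0 0<d primes)}}) ,
    (p , m , pp , m∣p-1 , refl) ,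
    subst (λ n → Φ n ≡ onePlusSTd (- altSign (r ∷ R)) d modT^ (2 * d)) (left-comm d p (product (r ∷ R)))
      (Φ-mod-T^2d cyclotomic 0<d p (r ∷ R) primes′ unique′ complete′)
    where
    R<p : All (_< p) (r ∷ R)
    R<p = All.tabulate (λ r′∈ → ∣∸1⇒< (∣-trans (∣-trans (∈⇒∣product r′∈) (∣n⇒∣m*n d ∣-refl)) m∣p-1) (prime>1 pp))
    open Admissible (Admissible-∷ adm pp R<p) renaming (primes to primes′; unique to unique′; complete to complete′)

lemma7p2 : (Φ : ℕ → Series) → IsCyclotomicFamily Φ →
    (d : ℕ) → 1 ≤ d → (s : ℤ) → (s ≡ + 1 ⊎ s ≡ - (+ 1)) →
    ∀ N → ∃[ n ] (N < n × SpecialForm n × Φ n ≡ onePlusSTd s d modT^ (2 * d))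
lemma7p2 Φ cyclotomic d 0<d s s≡±1 N = fix-sign (∃admissible-with-sign 0<d (negate-±1 s≡±1))
  where
  negate-±1 : ∀ {s} → s ≡ + 1 ⊎ s ≡ - + 1 → - s ≡ + 1 ⊎ - s ≡ - + 1
  negate-±1 (inj₁ refl) = inj₂ refl
  negate-±1 (inj₂ refl) = inj₁ refl
  fix-sign : ∃[ r ] ∃[ R ] Admissible d (r ∷ R) × altSign (r ∷ R) ≡ - s →
    ∃[ n ] (N < n × SpecialForm n × Φ n ≡ onePlusSTd s d modT^ (2 * d))
  fix-sign (r , R , adm , sign≡-s) =
    map₂ (λ {n} → map₂ (map₂ (subst (λ t → Φ n ≡ onePlusSTd t d modT^ (2 * d)) neg-sign≡s))) (∃special> cyclotomic 0<d r R adm N)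
    where
    neg-sign≡s : - altSign (r ∷ R) ≡ s
    neg-sign≡s = trans (cong -_ sign≡-s) (ℤP.neg-involutive s)
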